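{- Let $C:y^2=f(x)$ be a hyperelliptic curve of genus $g\ge 2$ over a local field $K$ of odd residue characteristic, $\deg f=2g+2$, with cluster picture $\Sigma$. The BY tree $T_\Sigma$ (with vertex colours and genera, edge colours and lengths) is uniquely determined by $T_C=(V,E,L)$ via the following procedure, for any choice of root in (i): (i) root $T_C$ at a proper vertex; (ii) colour a proper vertex yellow if it is übereven and blue otherwise; (iii) for a proper vertex $v$ define $g(v)$ by: the number of odd children of $v$ is $2g(v)+1$ or $2g(v)+2$; (iv) colour an edge $e$ between proper vertices yellow if the vertex at which it terminates (in the rooted direction) is even and blue otherwise, and label it with length $2L(e)$ if it is yellow and $L(e)$ if it is blue; (v) delete the singleton vertices and the edges to them.
   Context: $\mathrm{ord}$ is the valuation on $\bar K$ extending the normalised valuation of $K$; $\mathcal R$ = roots of $f$. Clusters: nonempty $\mathfrak s\subseteq\mathcal R$ of form $\mathcal R\cap\{x:\mathrm{ord}(x-z)\ge r\}$; proper if $|\mathfrak s|>1$; depth $d_{\mathfrak s}=\min_{r,r'\in\mathfrak s}\mathrm{ord}(r-r')$; parent $P(\mathfrak s)$ = smallest cluster strictly containing $\mathfrak s\ne\mathcal R$; $\delta_{\mathfrak s}=d_{\mathfrak s}-d_{P(\mathfrak s)}$; even/odd by size; übereven = proper, even, all children even. Stable model tree $T_C$: vertex $v_{\mathfrak s}$ per cluster (including singletons); for $\mathfrak s\ne\mathcal R$ an edge $v_{\mathfrak s}v_{P(\mathfrak s)}$ of length $\delta_{\mathfrak s}$ if proper, no length if singleton; if $\mathcal R$ is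 the disjoint union of exactly two children $\mathfrak s_1,\mathfrak s_2$, remove $v_{\mathcal R}$ and join $v_{\mathfrak s_1},v_{\mathfrak s_2}$ by one edge of length $\delta_{\mathfrak s_1}+\delta_{\mathfrak s_2}$ if both proper (no length otherwise). Singletons = vertices of one-element clusters; others proper. For $T_C$ rooted at a proper vertex: $w$ is a child of $v$ if there is an edge $vw$ directed from $v$ to $w$. The size of a proper vertex $v$ is the total number of singletons attached to proper vertices $w$ reachable from $v$ by a directed path (including $w=v$); a singleton has size 1. A vertex is even/odd by its size; a proper vertex is übereven if it is even and all its children are even. BY tree $T_\Sigma$: a vertex $v_{\mathfrak s}$ per proper cluster, omitting $v_{\mathcal R}$ (with its edges) when $\mathcal R$ has a child of size $2g+1$; yellow if $\mathfrak s$ übereven, blue otherwise; an edge $v_{\mathfrak s}v_{P(\mathfrak s)}$ for each proper $\mathfrak s\ne\mathcal R$, yellow of length $2\delta_{\mathfrak s}$ if $\mathfrak s$ even, blue of length $\delta_{\mathfrak s}$ if odd; if $\mathcal R$ is the disjoint union of two proper children, $v_{\mathcal R}$ is removed and its two edges merged (lengths added). Genus $g(v_{\mathfrak s})$: the number of odd children of $\mathfrak s$ is $2g(v_{\mathfrak s})+1$ or $2g(v_{\mathfrak s})+2$. -}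

module Defs where

open import Data.Nat as ℕ using (ℕ; suc)
open import Data.Nat.Divisibility using (_∣_)
open import Data.Fin using (Fin)
open import Data.Fin.Subset as Sub using (Subset; ⊤; ∣_∣; _⊆_; _⊂_; Nonempty)
open import Data.Rational as ℚ using (ℚ; _⊓_)
open import Data.List using (List; length)
open import Data.List.Membership.Propositional as LM using ()
open import Data.List.Relation.Unary.Unique.Propositional using (Unique)
open import Data.Product using (Σ; ∃; ∃-syntax; _×_)
open import Data.Sum using (_⊎_)
open import Relation.Nullary using (¬_)
open import Relation.Binary.PropositionalEquality using (_≡_; _≢_)
open import Function.Bundles using (_⇔_)

-- Abstract cluster data: the 2g+2 roots are indexed by Fin n, and
-- ord r r' stands for ord(r - r') (only used for r ≢ r').

Symmetric : ∀ {n} → (Fin n → Fin n → ℚ) → Set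
Symmetric {n} o = ∀ (i j : Fin n) → o i j ≡ o j i

Ultrametric : ∀ {n} → (Fin n → Fin n → ℚ) → Set
Ultrametric {n} o = ∀ (i j k : Fin n) → i ≢ j → j ≢ k → i ≢ k →
  (o i j ⊓ o j k) ℚ.≤ o i k

module Clusters {n : ℕ} (ord : Fin n → Fin n → ℚ) where

  -- s = R ∩ {x : ord(x - z) ≥ r}; the centre may be taken to be a root.
  IsCluster : Subset n → Set
  IsCluster s = Nonempty s × ∃[ z ] ∃[ r ]
    (∀ x → (x Sub.∈ s → (x ≡ z ⊎ r ℚ.≤ ord z x)) × ((x ≡ z ⊎ r ℚ.≤ ord z x) → x Sub.∈ s))

  Proper : Subset n → Set
  Proper s = IsCluster s × 1 ℕ.< ∣ s ∣

  EvenC : Subset n → Set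
  EvenC s = 2 ∣ (∣ s ∣)

  OddC : Subset n → Set
  OddC s = ¬ (2 ∣ (∣ s ∣))

  Depth : Subset n → ℚ → Set
  Depth s d = (∃[ r ] ∃[ r' ] (r Sub.∈ s × r' Sub.∈ s × r ≢ r' × ord r r' ≡ d))
            × (∀ r r' → r Sub.∈ s → r' Sub.∈ s → r ≢ r' → d ℚ.≤ ord r r')

  Parent : Subset n → Subset n → Set
  Parent s p = IsCluster s × IsCluster p × s ⊂ p × (∀ c → IsCluster c → s ⊂ c → p ⊆ c)

  Delta : Subset n → ℚ → Set
  Delta s δ = ∃[ p ] ∃[ d ] ∃[ dp ] (Parent s p × Depth s d × Depth p dp × δ ≡ d ℚ.- dp)

  Uebereven : Subset n → Set
  Uebereven s = Proper s × EvenC s × (∀ c → Parent c s → EvenC c)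

  OddChildren : Subset n → ℕ → Set
  OddChildren s m = Σ (List (Subset n)) λ xs → Unique xs ×
    (∀ c → (c LM.∈ xs) ⇔ (Parent c s × OddC c)) × length xs ≡ m

  TwoChildren : Set
  TwoChildren = ∃[ s₁ ] ∃[ s₂ ] (Parent s₁ ⊤ × Parent s₂ ⊤ × s₁ ≢ s₂ ×
    (∀ c → Parent c ⊤ → c ≡ s₁ ⊎ c ≡ s₂))

  TwoProperChildren : Set
  TwoProperChildren = ∃[ s₁ ] ∃[ s₂ ] (Parent s₁ ⊤ × Parent s₂ ⊤ × s₁ ≢ s₂ ×
    Proper s₁ × Proper s₂ × (∀ c → Parent c ⊤ → c ≡ s₁ ⊎ c ≡ s₂))

  BigChild : Set
  BigChild = ∃[ c ] (Parent c ⊤ × suc ∣ c ∣ ≡ n)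

-- Abstract trees with singleton marking and edge lengths (the shape of T_C)
-- Vertices are the elements x of X with IsV x; Edge is symmetric.

record LTree : Set₁ where
  field
    X    : Set
    IsV  : X → Set
    Sing : X → Set
    Edge : X → X → Set
    Len  : X → X → ℚ → Set

record BYTree : Set₁ where
  field
    X      : Set
    IsV    : X → Set
    Yellow : X → Set             -- blue = not yellow
    Genus  : X → ℕ → Set
    YEdge  : X → X → ℚ → Set
    BEdge  : X → X → ℚ → Set

record BYIso (A B : BYTree) : Set where
  private
    module A = BYTree A
    module B = BYTree B
  field
    to      : A.X → B.X
    from    : B.X → A.X
    to-V    : ∀ x → A.IsV x → B.IsV (to x)
    from-V  : ∀ y → B.IsV y → A.IsV (from y)
    from-to : ∀ x → A.IsV x → from (to x) ≡ x
    to-from : ∀ y → B.IsV y → to (from y) ≡ y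
    yellow  : ∀ x → A.IsV x → A.Yellow x ⇔ B.Yellow (to x)
    genus   : ∀ x k → A.IsV x → A.Genus x k ⇔ B.Genus (to x) k
    yedge   : ∀ x y ℓ → A.IsV x → A.IsV y → A.YEdge x y ℓ ⇔ B.YEdge (to x) (to y) ℓ
    bedge   : ∀ x y ℓ → A.IsV x → A.IsV y → A.BEdge x y ℓ ⇔ B.BEdge (to x) (to y) ℓ

module Procedure (T : LTree) (ρ : LTree.X T) where
  open LTree T

  data Walk : X → X → Set where
    here : ∀ x → Walk x x
    step : ∀ {x y z} → Edge x y → Walk y z → Walk x z

  Visits : ∀ {x y} → X → Walk x y → Set
  Visits v (here x) = v ≡ x
  Visits v (step {x} _ w) = v ≡ x ⊎ Visits v w

  -- w is reachable from v by a directed path (w = v allowed):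
  -- v lies on every walk from the root to w
  Desc : X → X → Set
  Desc v w = ∀ (p : Walk ρ w) → Visits v p

  Child : X → X → Set
  Child v w = Edge v w × Desc v w

  ProperV : X → Set
  ProperV v = IsV v × ¬ Sing v

  Size : X → ℕ → Set
  Size v k = Σ (List X) λ xs → Unique xs ×
    (∀ s → (s LM.∈ xs) ⇔ (Sing s × ∃[ u ] (ProperV u × Desc v u × Edge u s))) ×
    length xs ≡ k

  EvenV : X → Set
  EvenV v = ProperV v × ∃[ k ] (Size v k × 2 ∣ k)

  OddV : X → Set
  OddV v = (IsV v × Sing v) ⊎ (ProperV v × ∃[ k ] (Size v k × ¬ (2 ∣ k)))

  UeberevenV : X → Set
  UeberevenV v = ProperV v × EvenV v × (∀ w → Child v w → EvenV w)

  OddChildrenV : X → ℕ → Set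
  OddChildrenV v m = Σ (List X) λ xs → Unique xs ×
    (∀ w → (w LM.∈ xs) ⇔ (Child v w × OddV w)) × length xs ≡ m

  result : BYTree
  result = record
    { X      = X
    ; IsV    = ProperV
    ; Yellow = UeberevenV
    ; Genus  = λ v k → ∃[ m ] (OddChildrenV v m × (m ≡ 1 ℕ.+ 2 ℕ.* k ⊎ m ≡ 2 ℕ.+ 2 ℕ.* k))
    ; YEdge  = λ a b ℓ → ProperV a × ProperV b × Edge a b ×
                 ((Child a b × EvenV b) ⊎ (Child b a × EvenV a)) ×
                 ∃[ L ] (Len a b L × ℓ ≡ L ℚ.+ L)
    ; BEdge  = λ a b ℓ → ProperV a × ProperV b × Edge a b ×
                 ((Child a b × OddV b) ⊎ (Child b a × OddV a)) ×
                 ∃[ L ] (Len a b L × ℓ ≡ L)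
    }

module Trees {n : ℕ} (ord : Fin n → Fin n → ℚ) where
  open Clusters ord

  TCVert : Subset n → Set
  TCVert s = IsCluster s × ¬ (s ≡ ⊤ × TwoChildren)

  TCSing : Subset n → Set
  TCSing s = TCVert s × ∣ s ∣ ≡ 1

  TCEdge : Subset n → Subset n → Set
  TCEdge a b = (TCVert a × TCVert b × (Parent a b ⊎ Parent b a))
             ⊎ (TwoChildren × Parent a ⊤ × Parent b ⊤ × a ≢ b)

  TCLen : Subset n → Subset n → ℚ → Set
  TCLen a b ℓ = (TCVert a × TCVert b × Proper a × Proper b ×
                  ((Parent a b × Delta a ℓ) ⊎ (Parent b a × Delta b ℓ)))
              ⊎ (TwoChildren × Parent a ⊤ × Parent b ⊤ × a ≢ b × Proper a × Proper b ×
                  ∃[ δa ] ∃[ δb ] (Delta a δa × Delta b δb × ℓ ≡ δa ℚ.+ δb))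

  T-C : LTree
  T-C = record { X = Subset n ; IsV = TCVert ; Sing = TCSing ; Edge = TCEdge ; Len = TCLen }

  BYVert : Subset n → Set
  BYVert s = Proper s × ¬ (s ≡ ⊤ × (BigChild ⊎ TwoProperChildren))

  BYGenus : Subset n → ℕ → Set
  BYGenus s k = ∃[ m ] (OddChildren s m × (m ≡ 1 ℕ.+ 2 ℕ.* k ⊎ m ≡ 2 ℕ.+ 2 ℕ.* k))

  YEdgeDir : Subset n → Subset n → ℚ → Set
  YEdgeDir s p ℓ = BYVert s × BYVert p × Parent s p × EvenC s ×
                   ∃[ δ ] (Delta s δ × ℓ ≡ δ ℚ.+ δ)

  BEdgeDir : Subset n → Subset n → ℚ → Set
  BEdgeDir s p ℓ = BYVert s × BYVert p × Parent s p × OddC s × Delta s ℓ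

  Merged : Subset n → Subset n → Set
  Merged a b = TwoProperChildren × Parent a ⊤ × Parent b ⊤ × a ≢ b

  BYYEdge : Subset n → Subset n → ℚ → Set
  BYYEdge a b ℓ = YEdgeDir a b ℓ ⊎ YEdgeDir b a ℓ
    ⊎ (Merged a b × EvenC a × EvenC b × ∃[ δa ] ∃[ δb ]
        (Delta a δa × Delta b δb × ℓ ≡ (δa ℚ.+ δa) ℚ.+ (δb ℚ.+ δb)))

  BYBEdge : Subset n → Subset n → ℚ → Set
  BYBEdge a b ℓ = BEdgeDir a b ℓ ⊎ BEdgeDir b a ℓ
    ⊎ (Merged a b × OddC a × OddC b × ∃[ δa ] ∃[ δb ]
        (Delta a δa × Delta b δb × ℓ ≡ δa ℚ.+ δb))

  T-Σ : BYTree
  T-Σ = record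
    { X = Subset n ; IsV = BYVert ; Yellow = Uebereven ; Genus = BYGenus
    ; YEdge = BYYEdge ; BEdge = BYBEdge }

  ProperTC : Subset n → Set
  ProperTC s = TCVert s × ¬ TCSing s

-- Rooting T_C at a proper vertex ρ, the descendants of a vertex v can be read off the cluster
-- picture: they are the vertices inside v if ρ ⊄ v, all vertices if ρ = v, and the vertices not
-- inside c if ρ lies in the child c of v. (A walk can enter or leave the clusters inside a only
-- through a, and the path through the smallest cluster containing both ends shows the converse.)
-- Hence the size of v is ∣v∣, n or n ∸ ∣c∣, and as n = 2g+2 is even its parity is that of ∣v∣,
-- 0 or ∣c∣. The rooted children of v are its children in the cluster picture not containing ρ,
-- together with the neighbour of v towards R when ρ ⊆ v, whose size has the parity of ∣v∣. So every
-- edge terminates at a vertex with the parity of the lower cluster, übereven vertices correspond,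
-- and the numbers of odd children in the two senses differ at most by passing from an odd number m
-- to m + 1, which does not change the genus.

module Submission where

open import Defs
open import Data.Nat using (ℕ; _≤_; _+_; _*_)
open import Data.Fin using (Fin)
open import Data.Fin.Subset using (Subset)
open import Data.Rational using (ℚ)

open import Data.Nat as ℕ using (zero; suc; _∸_; _<_; s≤s; z≤n)
import Data.Nat.Properties as ℕP
open import Data.Nat.Divisibility using (_∣_; divides)
open import Data.Nat.ListAction using (sum)
open import Data.Parity.Base as ℙ using (Parity; 0ℙ; 1ℙ; _⁻¹)
import Data.Parity.Properties as ℙP
open import Data.Fin as Fin using (_≟_)
import Data.Fin.Properties as FinP
open import Data.Fin.Subset as Sub using (⊤; ⁅_⁆; ∁; ⋃; _∪_; _∈_; _∉_; _⊆_; _⊂_; ∣_∣)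
import Data.Fin.Subset.Properties as SubP
open import Data.Fin.Subset.Properties
  using (_∈?_; _⊆?_; ⊆-antisym; ⊆-reflexive; ⊆-trans; ⊆⊤; ∈⊤; x∈⁅x⁆; x∈⁅y⁆⇒x≡y; ∣⁅x⁆∣≡1; ∣⊤∣≡n;
         ∣∁p∣≡n∸∣p∣; x∉p⇒x∈∁p; x∈∁p⇒x∉p; x∈p∪q⁺)
open import Data.Fin.Subset.Induction using (⊃-wellFounded; Acc; acc)
open import Data.Rational as ℚ using (0ℚ; 1ℚ)
import Data.Rational.Properties as ℚP
open import Data.Bool using (true)
import Data.Bool.Properties as BoolP
open import Data.Vec as Vec using ([]; _∷_)
import Data.Vec.Properties as VecP
open import Data.List using (List; []; _∷_; length; map; filter; allFin; deduplicate)
import Data.List.Properties as ListP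
open import Data.List.Membership.Propositional using () renaming (_∈_ to _∈ₗ_)
import Data.List.Membership.Propositional.Properties as ∈P
open import Data.List.Membership.Propositional.Properties.WithK using (unique∧set⇒bag)
open import Data.List.Relation.Unary.Any using (here; there)
open import Data.List.Relation.Unary.All as All using (All)
open import Data.List.Relation.Unary.AllPairs as AllPairs using ()
open import Data.List.Relation.Unary.Unique.Propositional using (Unique)
import Data.List.Relation.Unary.Unique.Propositional.Properties as UniqueP
open import Data.List.Relation.Unary.Unique.DecPropositional.Properties using (deduplicate-!)
open import Data.List.Relation.Binary.BagAndSetEquality using (∼bag⇒↭)
open import Data.List.Relation.Binary.Permutation.Propositional.Properties using (↭-length)
open import Relation.Binary.Bundles using (DecTotalOrder)
open import Data.List.Extrema (DecTotalOrder.totalOrder ℚP.≤-decTotalOrder)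
  using (argmax; argmax-all; f[xs]≤f[argmax]; max; xs≤max; min; min≤xs)
open import Algebra.Bundles using (CommutativeMonoid)
open import Algebra.Properties.CommutativeSemigroup
  (CommutativeMonoid.commutativeSemigroup ℚP.+-0-commutativeMonoid) using (interchange)
open import Data.Product as Product using (Σ; ∃; ∃-syntax; _×_; _,_; proj₁; proj₂)
open import Data.Sum as Sum using (_⊎_; inj₁; inj₂)
open import Data.Empty using (⊥; ⊥-elim)
open import Relation.Nullary using (¬_; Dec; yes; no; does; ¬?; contradiction; _×-dec_; _⊎-dec_)
import Relation.Nullary.Decidable as Dec
open import Relation.Unary using (Decidable)
open import Relation.Binary.PropositionalEquality
open import Function using (_∘_; id; Injective)
open import Function.Bundles using (_⇔_; mk⇔; Equivalence)
import Function.Properties.Equivalence as ⇔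
open Equivalence using (to; from)

private variable n : ℕ

-- Lists and finite subsets

unique∧set⇒length≡ : ∀ {a} {A : Set a} {xs ys : List A} → Unique xs → Unique ys →
                     (∀ z → z ∈ₗ xs ⇔ z ∈ₗ ys) → length xs ≡ length ys
unique∧set⇒length≡ ux uy xs≈ys = ↭-length (∼bag⇒↭ (unique∧set⇒bag ux uy λ {z} → xs≈ys z))

module _ {a p} {A : Set a} {P : A → Set p} (P? : Decidable P) where

  length-filter-one-rejected :
    ∀ {xs} → Unique xs → (∀ {y z} → y ∈ₗ xs → z ∈ₗ xs → ¬ P y → ¬ P z → y ≡ z) →
    length xs ≡ length (filter P? xs) ⊎ (length xs ≡ suc (length (filter P? xs)) × ∃[ y ] (y ∈ₗ xs × ¬ P y))
  length-filter-one-rejected {[]}     _                    _       = inj₁ refl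
  length-filter-one-rejected {x ∷ xs} (x∉xs AllPairs.∷ u) at-most-one with P? x
  ... | yes _ with length-filter-one-rejected u (λ y∈ z∈ → at-most-one (there y∈) (there z∈))
  ...   | inj₁ len                 = inj₁ (cong suc len)
  ...   | inj₂ (len , y , y∈ , ¬Py) = inj₂ (cong suc len , y , there y∈ , ¬Py)
  length-filter-one-rejected {x ∷ xs} (x∉xs AllPairs.∷ u) at-most-one | no ¬Px =
    inj₂ (cong (suc ∘ length) (sym (ListP.filter-all P? (All.tabulate all-P))) , x , here refl , ¬Px)
    where
    all-P : ∀ {y} → y ∈ₗ xs → P y
    all-P {y} y∈ with P? y
    ... | yes Py = Py
    ... | no ¬Py = ⊥-elim (All.lookup x∉xs y∈ (at-most-one (here refl) (there y∈) ¬Px ¬Py))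

enumerate : Subset n → List (Fin n)
enumerate []                = []
enumerate (Sub.inside ∷ s)  = Fin.zero ∷ map Fin.suc (enumerate s)
enumerate (Sub.outside ∷ s) = map Fin.suc (enumerate s)

length-enumerate : (s : Subset n) → length (enumerate s) ≡ ∣ s ∣
length-enumerate []                = refl
length-enumerate (Sub.inside ∷ s)  =
  cong suc (trans (ListP.length-map Fin.suc (enumerate s)) (length-enumerate s))
length-enumerate (Sub.outside ∷ s) = trans (ListP.length-map Fin.suc (enumerate s)) (length-enumerate s)

zero∉map-suc : (xs : List (Fin n)) → ¬ (Fin.zero ∈ₗ map Fin.suc xs)
zero∉map-suc xs z∈ with ∈P.∈-map⁻ Fin.suc z∈
... | _ , _ , ()

enumerate-unique : (s : Subset n) → Unique (enumerate s)
enumerate-unique []                = AllPairs.[]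
enumerate-unique (Sub.inside ∷ s)  =
  All.tabulate (λ y∈ z≡y → zero∉map-suc _ (subst (_∈ₗ _) (sym z≡y) y∈))
  AllPairs.∷ UniqueP.map⁺ FinP.suc-injective (enumerate-unique s)
enumerate-unique (Sub.outside ∷ s) = UniqueP.map⁺ FinP.suc-injective (enumerate-unique s)

∈-map-suc⇔ : ∀ {x} (xs : List (Fin n)) → Fin.suc x ∈ₗ map Fin.suc xs ⇔ x ∈ₗ xs
∈-map-suc⇔ xs = mk⇔ (λ h → let (y , y∈ , x≡y) = ∈P.∈-map⁻ Fin.suc h
                            in subst (_∈ₗ xs) (sym (FinP.suc-injective x≡y)) y∈)
                    (∈P.∈-map⁺ Fin.suc)

∈-enumerate : (s : Subset n) (x : Fin n) → x ∈ₗ enumerate s ⇔ x ∈ s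
∈-enumerate (Sub.inside ∷ s)  Fin.zero    = mk⇔ (λ _ → Vec.here) (λ _ → here refl)
∈-enumerate (Sub.outside ∷ s) Fin.zero    = mk⇔ (⊥-elim ∘ zero∉map-suc _) (λ ())
∈-enumerate (Sub.inside ∷ s)  (Fin.suc x) =
  mk⇔ (λ { (there h) → Vec.there (to (∈-enumerate s x) (to (∈-map-suc⇔ _) h)) })
      (λ { (Vec.there h) → there (from (∈-map-suc⇔ _) (from (∈-enumerate s x) h)) })
∈-enumerate (Sub.outside ∷ s) (Fin.suc x) =
  mk⇔ (λ h → Vec.there (to (∈-enumerate s x) (to (∈-map-suc⇔ _) h)))
      (λ { (Vec.there h) → from (∈-map-suc⇔ _) (from (∈-enumerate s x) h) })

Image : ∀ {b} {B : Set b} → (Fin n → B) → Subset n → B → Set b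
Image f s t = ∃[ x ] (t ≡ f x × x ∈ s)

∈-map-enumerate : ∀ {b} {B : Set b} (f : Fin n → B) s t → t ∈ₗ map f (enumerate s) ⇔ Image f s t
∈-map-enumerate f s t =
  mk⇔ (λ h → let (x , x∈ , t≡fx) = ∈P.∈-map⁻ f h in x , t≡fx , to (∈-enumerate s x) x∈)
      (λ (x , t≡fx , x∈s) → subst (_∈ₗ _) (sym t≡fx) (∈P.∈-map⁺ f (from (∈-enumerate s x) x∈s)))

module _ {b} {B : Set b} {f : Fin n → B} (f-injective : Injective _≡_ _≡_ f) where

  map-enumerate-unique : ∀ s → Unique (map f (enumerate s))
  map-enumerate-unique s = UniqueP.map⁺ f-injective (enumerate-unique s)

  unique∧image⇒length≡∣∣ : ∀ {s zs} → Unique zs → (∀ t → t ∈ₗ zs ⇔ Image f s t) → length zs ≡ ∣ s ∣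
  unique∧image⇒length≡∣∣ {s} {zs} u zs≈fs =
    trans (unique∧set⇒length≡ u (map-enumerate-unique s)
             (λ t → mk⇔ (from (∈-map-enumerate f s t) ∘ to (zs≈fs t))
                        (from (zs≈fs t) ∘ to (∈-map-enumerate f s t))))
          (trans (ListP.length-map f (enumerate s)) (length-enumerate s))

⟦_⟧ : {P : Fin n → Set} → Decidable P → Subset n
⟦ P? ⟧ = Vec.tabulate (does ∘ P?)

∈⟦⟧⇔ : ∀ {P : Fin n → Set} (P? : Decidable P) x → x ∈ ⟦ P? ⟧ ⇔ P x
∈⟦⟧⇔ P? x = mk⇔ (λ x∈ → does⇒ (P? x) (trans (sym (VecP.lookup∘tabulate _ x)) (VecP.[]=⇒lookup x∈)))
                (λ Px → VecP.lookup⇒[]= x _ (trans (VecP.lookup∘tabulate _ x) (Dec.dec-true (P? x) Px)))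
  where
  does⇒ : ∀ {A : Set} (a? : Dec A) → does a? ≡ true → A
  does⇒ (yes a) _ = a

Disjoint : Subset n → Subset n → Set
Disjoint p q = ∀ {x} → x ∈ p → x ∈ q → ⊥

∣p∪q∣≡∣p∣+∣q∣ : (p q : Subset n) → Disjoint p q → ∣ p ∪ q ∣ ≡ ∣ p ∣ + ∣ q ∣
∣p∪q∣≡∣p∣+∣q∣ []                []                _   = refl
∣p∪q∣≡∣p∣+∣q∣ (Sub.inside ∷ p)  (Sub.inside ∷ q)  p#q = ⊥-elim (p#q Vec.here Vec.here)
∣p∪q∣≡∣p∣+∣q∣ (Sub.inside ∷ p)  (Sub.outside ∷ q) p#q =
  cong suc (∣p∪q∣≡∣p∣+∣q∣ p q λ x∈p x∈q → p#q (Vec.there x∈p) (Vec.there x∈q))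
∣p∪q∣≡∣p∣+∣q∣ (Sub.outside ∷ p) (Sub.inside ∷ q)  p#q =
  trans (cong suc (∣p∪q∣≡∣p∣+∣q∣ p q λ x∈p x∈q → p#q (Vec.there x∈p) (Vec.there x∈q)))
        (sym (ℕP.+-suc ∣ p ∣ ∣ q ∣))
∣p∪q∣≡∣p∣+∣q∣ (Sub.outside ∷ p) (Sub.outside ∷ q) p#q =
  ∣p∪q∣≡∣p∣+∣q∣ p q λ x∈p x∈q → p#q (Vec.there x∈p) (Vec.there x∈q)

∈⋃⁻ : ∀ (cs : List (Subset n)) {x} → x ∈ ⋃ cs → ∃[ c ] (c ∈ₗ cs × x ∈ c)
∈⋃⁻ []       x∈ = ⊥-elim (SubP.∉⊥ x∈)
∈⋃⁻ (c ∷ cs) x∈ with SubP.x∈p∪q⁻ c (⋃ cs) x∈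
... | inj₁ x∈c  = c , here refl , x∈c
... | inj₂ x∈cs = let (c' , c'∈ , x∈c') = ∈⋃⁻ cs x∈cs in c' , there c'∈ , x∈c'

∈⋃⁺ : ∀ (cs : List (Subset n)) {c x} → c ∈ₗ cs → x ∈ c → x ∈ ⋃ cs
∈⋃⁺ (c ∷ cs) (here refl) x∈c = x∈p∪q⁺ (inj₁ x∈c)
∈⋃⁺ (c ∷ cs) (there c∈) x∈c = x∈p∪q⁺ (inj₂ (∈⋃⁺ cs c∈ x∈c))

∣⋃∣≡sum : ∀ (cs : List (Subset n)) → Unique cs →
          (∀ {c c'} → c ∈ₗ cs → c' ∈ₗ cs → c ≢ c' → Disjoint c c') →
          ∣ ⋃ cs ∣ ≡ sum (map ∣_∣ cs)
∣⋃∣≡sum {n} []       _ _ = SubP.∣⊥∣≡0 n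
∣⋃∣≡sum (c ∷ cs) (c∉cs AllPairs.∷ u) disjoint =
  trans (∣p∪q∣≡∣p∣+∣q∣ c (⋃ cs) c#⋃cs)
        (cong (∣ c ∣ +_) (∣⋃∣≡sum cs u λ c∈ c'∈ → disjoint (there c∈) (there c'∈)))
  where
  c#⋃cs : Disjoint c (⋃ cs)
  c#⋃cs x∈c x∈⋃ = let (c' , c'∈ , x∈c') = ∈⋃⁻ cs x∈⋃
                  in disjoint (here refl) (there c'∈) (All.lookup c∉cs c'∈) x∈c x∈c'

_≟ˢ_ : (p q : Subset n) → Dec (p ≡ q)
_≟ˢ_ = VecP.≡-dec BoolP._≟_

⊆∧≢⇒⊂ : ∀ {p q : Subset n} → p ⊆ q → p ≢ q → p ⊂ q
⊆∧≢⇒⊂ {p = p} {q} p⊆q p≢q with FinP.any? (λ x → x ∈? q ×-dec ¬? (x ∈? p))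
... | yes (x , x∈q , x∉p) = p⊆q , x , x∈q , x∉p
... | no ∄ = contradiction (⊆-antisym p⊆q q⊆p) p≢q
  where
  q⊆p : q ⊆ p
  q⊆p {x} x∈q with x ∈? p
  ... | yes x∈p = x∈p
  ... | no x∉p  = contradiction (x , x∈q , x∉p) ∄

≢⊤⇒∃∉ : ∀ {p : Subset n} → p ≢ ⊤ → ∃[ x ] x ∉ p
≢⊤⇒∃∉ p≢⊤ = let (_ , x , _ , x∉p) = ⊆∧≢⇒⊂ ⊆⊤ p≢⊤ in x , x∉p

⊂⇒∃∉ : ∀ {p q : Subset n} → p ⊂ q → ∃[ x ] x ∉ p
⊂⇒∃∉ (_ , x , _ , x∉p) = x , x∉p

⊂⇒⊉ : ∀ {p q : Subset n} → p ⊂ q → ¬ (q ⊆ p)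
⊂⇒⊉ (_ , x , x∈q , x∉p) q⊆p = x∉p (q⊆p x∈q)

x∈p⇒0<∣p∣ : ∀ {p : Subset n} {x} → x ∈ p → 0 ℕ.< ∣ p ∣
x∈p⇒0<∣p∣ {x = x} x∈p =
  subst (ℕ._≤ _) (∣⁅x⁆∣≡1 x) (SubP.p⊆q⇒∣p∣≤∣q∣ λ y∈⁅x⁆ → subst (_∈ _) (sym (x∈⁅y⁆⇒x≡y x y∈⁅x⁆)) x∈p)

∣p∣≡1⇒≡⁅⁆ : ∀ (p : Subset n) → ∣ p ∣ ≡ 1 → ∃[ x ] p ≡ ⁅ x ⁆
∣p∣≡1⇒≡⁅⁆ p ∣p∣≡1 with enumerate p | length-enumerate p | ∈-enumerate p
... | []        | len | _ = contradiction (trans len ∣p∣≡1) λ ()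
... | _ ∷ _ ∷ _ | len | _ = contradiction (trans len ∣p∣≡1) λ ()
... | x ∷ []    | _   | ∈p = x , ⊆-antisym p⊆⁅x⁆ ⁅x⁆⊆p
  where
  p⊆⁅x⁆ : p ⊆ ⁅ x ⁆
  p⊆⁅x⁆ {y} y∈p with from (∈p y) y∈p
  ... | here refl = x∈⁅x⁆ x
  ⁅x⁆⊆p : ⁅ x ⁆ ⊆ p
  ⁅x⁆⊆p y∈⁅x⁆ = to (∈p _) (here (x∈⁅y⁆⇒x≡y x y∈⁅x⁆))

suc∣p∣≡n⇒∉-unique : ∀ {p : Subset n} {x y} → suc ∣ p ∣ ≡ n → x ∉ p → y ∉ p → y ≡ x
suc∣p∣≡n⇒∉-unique {n} {p} ∣p∣+1≡n x∉p y∉p = trans (outside⇒≡z y∉p) (sym (outside⇒≡z x∉p))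
  where
  ∣∁p∣≡1 : ∣ ∁ p ∣ ≡ 1
  ∣∁p∣≡1 = trans (∣∁p∣≡n∸∣p∣ p) (trans (cong (_∸ ∣ p ∣) (sym ∣p∣+1≡n)) (ℕP.m+n∸n≡m 1 ∣ p ∣))
  z = proj₁ (∣p∣≡1⇒≡⁅⁆ (∁ p) ∣∁p∣≡1)
  outside⇒≡z : ∀ {w} → w ∉ p → w ≡ z
  outside⇒≡z w∉p = x∈⁅y⁆⇒x≡y z (subst (_ ∈_) (proj₂ (∣p∣≡1⇒≡⁅⁆ (∁ p) ∣∁p∣≡1)) (x∉p⇒x∈∁p w∉p))

⁅⁆-injective : Injective _≡_ _≡_ (⁅_⁆ {n})
⁅⁆-injective {x = x} {y = y} ⁅x⁆≡⁅y⁆ = x∈⁅y⁆⇒x≡y y (subst (x ∈_) ⁅x⁆≡⁅y⁆ (x∈⁅x⁆ x))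

⁅x⁆⊆p⇔x∈p : ∀ {x} {p : Subset n} → ⁅ x ⁆ ⊆ p ⇔ x ∈ p
⁅x⁆⊆p⇔x∈p {x = x} {p} = mk⇔ {A = ⁅ x ⁆ ⊆ p} (λ ⁅x⁆⊆p → ⁅x⁆⊆p (x∈⁅x⁆ x)) ⁅x⁆⊆p
  where
  ⁅x⁆⊆p : x ∈ p → ⁅ x ⁆ ⊆ p
  ⁅x⁆⊆p x∈p y∈⁅x⁆ = subst (_∈ p) (sym (x∈⁅y⁆⇒x≡y x y∈⁅x⁆)) x∈p

-- Parity

HasParity : Parity → ℕ → Set
HasParity 0ℙ m = 2 ∣ m
HasParity 1ℙ m = ¬ (2 ∣ m)

2∣⇒parity≡0ℙ : ∀ {m} → 2 ∣ m → ℕ.parity m ≡ 0ℙ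
2∣⇒parity≡0ℙ (divides q refl) = go q
  where
  go : ∀ q → ℕ.parity (q ℕ.* 2) ≡ 0ℙ
  go zero    = refl
  go (suc q) = go q

parity≡0ℙ⇒2∣ : ∀ m → ℕ.parity m ≡ 0ℙ → 2 ∣ m
parity≡0ℙ⇒2∣ zero          _  = divides 0 refl
parity≡0ℙ⇒2∣ (suc (suc m)) eq with parity≡0ℙ⇒2∣ m eq
... | divides q refl = divides (suc q) refl

hasParity⇔ : ∀ p m → HasParity p m ⇔ ℕ.parity m ≡ p
hasParity⇔ 0ℙ m = mk⇔ 2∣⇒parity≡0ℙ (parity≡0ℙ⇒2∣ m)
hasParity⇔ 1ℙ m = mk⇔ odd (λ eq 2∣m → ℙP.p≢p⁻¹ 0ℙ (trans (sym (2∣⇒parity≡0ℙ 2∣m)) eq))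
  where
  odd : ¬ (2 ∣ m) → ℕ.parity m ≡ 1ℙ
  odd ¬2∣m with ℕ.parity m in eq
  ... | 0ℙ = contradiction (parity≡0ℙ⇒2∣ m eq) ¬2∣m
  ... | 1ℙ = refl

p+q≡0ℙ⇒p≡q : ∀ {p q} → p ℙ.+ q ≡ 0ℙ → p ≡ q
p+q≡0ℙ⇒p≡q {0ℙ} {0ℙ} _ = refl
p+q≡0ℙ⇒p≡q {1ℙ} {1ℙ} _ = refl

parity[m∸k]≡parity[k] : ∀ {m k} → ℕ.parity m ≡ 0ℙ → k ℕ.≤ m → ℕ.parity (m ∸ k) ≡ ℕ.parity k
parity[m∸k]≡parity[k] {m} {k} even k≤m = p+q≡0ℙ⇒p≡q (begin
  ℕ.parity (m ∸ k) ℙ.+ ℕ.parity k ≡⟨ ℙP.+-homo-+ (m ∸ k) k ⟨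
  ℕ.parity (m ∸ k + k)            ≡⟨ cong ℕ.parity (ℕP.m∸n+n≡m k≤m) ⟩
  ℕ.parity m                      ≡⟨ even ⟩
  0ℙ                              ∎)
  where open ≡-Reasoning

p≢1ℙ⇒p≡0ℙ : ∀ {p} → p ≢ 1ℙ → p ≡ 0ℙ
p≢1ℙ⇒p≡0ℙ {0ℙ} _   = refl
p≢1ℙ⇒p≡0ℙ {1ℙ} ≢1ℙ = contradiction refl ≢1ℙ

module _ {a} {A : Set a} (f : A → ℕ) where

  odd? : (x : A) → Dec (ℕ.parity (f x) ≡ 1ℙ)
  odd? x = ℕ.parity (f x) ℙP.≟ 1ℙ

  parity-sum : ∀ xs → ℕ.parity (sum (map f xs)) ≡ ℕ.parity (length (filter odd? xs))
  parity-sum []       = refl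
  parity-sum (x ∷ xs) with odd? x
  ... | yes odd = begin
    ℕ.parity (f x + sum (map f xs))             ≡⟨ ℙP.+-homo-+ (f x) _ ⟩
    ℕ.parity (f x) ℙ.+ ℕ.parity (sum (map f xs)) ≡⟨ cong₂ ℙ._+_ odd (parity-sum xs) ⟩
    ℕ.parity (length (filter odd? xs)) ⁻¹        ≡⟨ ℙP.suc-homo-⁻¹ (suc (length (filter odd? xs))) ⟩
    ℕ.parity (suc (length (filter odd? xs)))     ∎
    where open ≡-Reasoning
  ... | no ¬odd = begin
    ℕ.parity (f x + sum (map f xs))              ≡⟨ ℙP.+-homo-+ (f x) _ ⟩
    ℕ.parity (f x) ℙ.+ ℕ.parity (sum (map f xs)) ≡⟨ cong₂ ℙ._+_ (p≢1ℙ⇒p≡0ℙ ¬odd) (parity-sum xs) ⟩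
    ℕ.parity (length (filter odd? xs))           ∎
    where open ≡-Reasoning

GenusCount : ℕ → ℕ → Set
GenusCount m k = m ≡ 1 + 2 ℕ.* k ⊎ m ≡ 2 + 2 ℕ.* k

odd⇒genusCount-suc⇔ : ∀ {m} → ℕ.parity m ≡ 1ℙ → ∀ k → GenusCount (suc m) k ⇔ GenusCount m k
odd⇒genusCount-suc⇔ {m} odd k = mk⇔ down up
  where
  not-odd : ∀ {m'} → ℕ.parity m' ≡ ℕ.parity (2 ℕ.* k) → ℕ.parity m' ≢ 1ℙ
  not-odd eq odd' = ℙP.p≢p⁻¹ 0ℙ (trans (sym (trans eq (ℙP.*-homo-* 2 k))) odd')
  down : GenusCount (suc m) k → GenusCount m k
  down (inj₁ eq) = ⊥-elim (not-odd {m} (cong ℕ.parity (ℕP.suc-injective eq)) odd)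
  down (inj₂ eq) = inj₁ (ℕP.suc-injective eq)
  up : GenusCount m k → GenusCount (suc m) k
  up (inj₁ eq) = inj₂ (cong suc eq)
  up (inj₂ eq) = ⊥-elim (not-odd {m} (cong ℕ.parity eq) odd)

-- r and o will count the odd children of a vertex in the rooted and in the cluster sense, and b
-- those odd children of it in the cluster sense that do not contain the root
genusCount-cong : ∀ {A : Set} {b r o} →
                  (r ≡ b × (A → ℕ.parity o ≡ 0ℙ)) ⊎ (r ≡ suc b × ℕ.parity o ≡ 1ℙ) →
                  o ≡ b ⊎ (o ≡ suc b × A) → ∀ k → GenusCount r k ⇔ GenusCount o k
genusCount-cong (inj₁ (refl , _))     (inj₁ refl)       k = ⇔.refl
genusCount-cong (inj₂ (refl , _))     (inj₂ (refl , _)) k = ⇔.refl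
genusCount-cong (inj₂ (refl , odd))   (inj₁ refl)       k = odd⇒genusCount-suc⇔ odd k
genusCount-cong {b = b} (inj₁ (refl , even)) (inj₂ (refl , a)) k =
  ⇔.sym (odd⇒genusCount-suc⇔ (trans (sym (ℙP.suc-homo-⁻¹ b)) (cong _⁻¹ (even a))) k)

-- Cluster pictures

p<p+1 : ∀ p → p ℚ.< p ℚ.+ 1ℚ
p<p+1 p = subst (ℚ._< p ℚ.+ 1ℚ) (ℚP.+-identityʳ p) (ℚP.+-mono-≤-< (ℚP.≤-refl {p}) (ℚP.positive⁻¹ 1ℚ))

module ClusterPicture {n : ℕ} (ord : Fin n → Fin n → ℚ)
                      (ord-sym : Symmetric ord) (ord-ultra : Ultrametric ord) where
  open Clusters ord

  InBall : Fin n → ℚ → Fin n → Set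
  InBall z r x = x ≡ z ⊎ r ℚ.≤ ord z x

  InBall? : ∀ z r → Decidable (InBall z r)
  InBall? z r x = (x ≟ z) ⊎-dec (r ℚ.≤? ord z x)

  IsBall : Subset n → Fin n → ℚ → Set
  IsBall s z r = ∀ x → (x ∈ s → InBall z r x) × (InBall z r x → x ∈ s)

  InBall-sym : ∀ {z r x} → InBall z r x → InBall x r z
  InBall-sym (inj₁ refl) = inj₁ refl
  InBall-sym {z} {r} {x} (inj₂ r≤zx) = inj₂ (subst (r ℚ.≤_) (ord-sym z x) r≤zx)

  InBall-trans : ∀ {z r x y} → InBall z r x → InBall x r y → InBall z r y
  InBall-trans (inj₁ refl) x~y = x~y
  InBall-trans z~x (inj₁ refl) = z~x
  InBall-trans {z} {r} {x} {y} (inj₂ r≤zx) (inj₂ r≤xy) with y ≟ z | x ≟ z | y ≟ x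
  ... | yes y≡z | _        | _        = inj₁ y≡z
  ... | no _    | yes refl | _        = inj₂ r≤xy
  ... | no _    | no _     | yes refl = inj₂ r≤zx
  ... | no y≢z  | no x≢z   | no y≢x   =
    inj₂ (ℚP.≤-trans (ℚP.⊓-glb r≤zx r≤xy) (ord-ultra z x y (x≢z ∘ sym) (y≢x ∘ sym) (y≢z ∘ sym)))

  InBall-mono : ∀ {z r t x} → r ℚ.≤ t → InBall z t x → InBall z r x
  InBall-mono r≤t (inj₁ x≡z)  = inj₁ x≡z
  InBall-mono r≤t (inj₂ t≤zx) = inj₂ (ℚP.≤-trans r≤t t≤zx)

  ball-recentre : ∀ {s z r w} → IsBall s z r → w ∈ s → IsBall s w r
  ball-recentre s-ball w∈s x =
    (λ x∈s → InBall-trans (InBall-sym z~w) (proj₁ (s-ball x) x∈s)) ,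
    (λ w~x → proj₂ (s-ball x) (InBall-trans z~w w~x))
    where z~w = proj₁ (s-ball _) w∈s

  cluster-ball : ∀ {s w} → IsCluster s → w ∈ s → ∃[ r ] IsBall s w r
  cluster-ball (_ , _ , r , s-ball) w∈s = r , ball-recentre s-ball w∈s

  clusters-nest : ∀ {a b x} → IsCluster a → IsCluster b → x ∈ a → x ∈ b → a ⊆ b ⊎ b ⊆ a
  clusters-nest ca cb x∈a x∈b with cluster-ball ca x∈a | cluster-ball cb x∈b
  ... | r , a-ball | t , b-ball with ℚP.≤-total r t
  ... | inj₁ r≤t = inj₂ λ {y} y∈b → proj₂ (a-ball y) (InBall-mono r≤t (proj₁ (b-ball y) y∈b))
  ... | inj₂ t≤r = inj₁ λ {y} y∈a → proj₂ (b-ball y) (InBall-mono t≤r (proj₁ (a-ball y) y∈a))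

  ⁅⁆-isCluster : ∀ x → IsCluster ⁅ x ⁆
  ⁅⁆-isCluster x = (x , x∈⁅x⁆ x) , x , r , λ y →
    (λ y∈⁅x⁆ → inj₁ (x∈⁅y⁆⇒x≡y x y∈⁅x⁆)) ,
    λ { (inj₁ refl) → x∈⁅x⁆ x ; (inj₂ r≤xy) → ⊥-elim (ℚP.<-irrefl refl (ℚP.<-≤-trans (xy<r y) r≤xy)) }
    where
    distances = map (ord x) (allFin n)
    r = max 0ℚ distances ℚ.+ 1ℚ
    xy<r : ∀ y → ord x y ℚ.< r
    xy<r y = ℚP.≤-<-trans (All.lookup (xs≤max 0ℚ distances) (∈P.∈-map⁺ (ord x) (∈P.∈-allFin y)))
                          (p<p+1 _)

  ⊤-isCluster : Fin n → IsCluster ⊤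
  ⊤-isCluster z = (z , ∈⊤) , z , min 0ℚ distances , λ y →
    (λ _ → inj₂ (All.lookup (min≤xs 0ℚ distances) (∈P.∈-map⁺ (ord z) (∈P.∈-allFin y)))) , (λ _ → ∈⊤)
    where distances = map (ord z) (allFin n)

  -- P(s) is the disc around z ∈ s reaching the nearest root y* ∉ s, i.e. the one maximising ord z y*
  parent-exists : ∀ {s} → IsCluster s → ∃[ y ] y ∉ s → ∃[ p ] Parent s p
  parent-exists {s} cs@((z , z∈s) , _) (y₀ , y₀∉s) =
    p , cs , p-cluster , (s⊆p , y* , y*∈p , y*∉s) , p-least
    where
    r = proj₁ (cluster-ball cs z∈s)
    s-ball = proj₂ (cluster-ball cs z∈s)
    non-members = filter (λ y → ¬? (y ∈? s)) (allFin n)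
    y* = argmax (ord z) y₀ non-members
    y*∉s : y* ∉ s
    y*∉s = argmax-all (ord z) {P = _∉ s} y₀∉s
             (All.tabulate (proj₂ ∘ ∈P.∈-filter⁻ (λ y → ¬? (y ∈? s)) {xs = allFin n}))
    farthest : ∀ y → y ∉ s → ord z y ℚ.≤ ord z y*
    farthest y y∉s = All.lookup (f[xs]≤f[argmax] y₀ non-members) (∈P.∈-filter⁺ _ (∈P.∈-allFin y) y∉s)
    p = ⟦ InBall? z (ord z y*) ⟧
    p-ball : IsBall p z (ord z y*)
    p-ball x = to (∈⟦⟧⇔ (InBall? z (ord z y*)) x) , from (∈⟦⟧⇔ (InBall? z (ord z y*)) x)
    p-cluster : IsCluster p
    p-cluster = (z , proj₂ (p-ball z) (inj₁ refl)) , z , ord z y* , p-ball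
    y*<r : ord z y* ℚ.< r
    y*<r = ℚP.≰⇒> λ r≤ → y*∉s (proj₂ (s-ball y*) (inj₂ r≤))
    s⊆p : s ⊆ p
    s⊆p {x} x∈s = proj₂ (p-ball x) (InBall-mono (ℚP.<⇒≤ y*<r) (proj₁ (s-ball x) x∈s))
    y*∈p : y* ∈ p
    y*∈p = proj₂ (p-ball y*) (inj₂ ℚP.≤-refl)
    p-least : ∀ c → IsCluster c → s ⊂ c → p ⊆ c
    p-least c cc (s⊆c , y , y∈c , y∉s) {x} x∈p with cluster-ball cc (s⊆c z∈s)
    ... | t , c-ball with proj₁ (c-ball y) y∈c
    ... | inj₁ refl = contradiction z∈s y∉s
    ... | inj₂ t≤zy = proj₂ (c-ball x) (InBall-mono (ℚP.≤-trans t≤zy (farthest y y∉s)) (proj₁ (p-ball x) x∈p))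

  parent-unique : ∀ {s p q} → Parent s p → Parent s q → p ≡ q
  parent-unique (_ , cp , s⊂p , p-least) (_ , cq , s⊂q , q-least) =
    ⊆-antisym (p-least _ cq s⊂q) (q-least _ cp s⊂p)

  parent-⊂ : ∀ {s p} → Parent s p → s ⊂ p
  parent-⊂ (_ , _ , s⊂p , _) = s⊂p

  parent-⊆ : ∀ {s p} → Parent s p → s ⊆ p
  parent-⊆ = proj₁ ∘ parent-⊂

  parent-nonempty : ∀ {s p} → Parent s p → ∃[ x ] x ∈ s
  parent-nonempty ((x∈s , _) , _) = x∈s

  siblings-equal : ∀ {s c c' x} → Parent c s → Parent c' s → x ∈ c → x ∈ c' → c ≡ c'
  siblings-equal {c = c} {c'} pc@(cc , _ , c⊂s , c-least) pc'@(cc' , _ , c'⊂s , c'-least) x∈c x∈c'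
    with clusters-nest cc cc' x∈c x∈c' | c ≟ˢ c'
  ... | _          | yes c≡c' = c≡c'
  ... | inj₁ c⊆c'  | no c≢c'  = ⊥-elim (⊂⇒⊉ c'⊂s (c-least _ cc' (⊆∧≢⇒⊂ c⊆c' c≢c')))
  ... | inj₂ c'⊆c  | no c≢c'  = ⊥-elim (⊂⇒⊉ c⊂s (c'-least _ cc (⊆∧≢⇒⊂ c'⊆c (c≢c' ∘ sym))))

  sibling-⊆⇒≡ : ∀ {s c c'} → Parent c s → Parent c' s → c ⊆ c' → c ≡ c'
  sibling-⊆⇒≡ c-s c'-s c⊆c' = let (x , x∈c) = parent-nonempty c-s in siblings-equal c-s c'-s x∈c (c⊆c' x∈c)

  climb : ∀ {s w} → IsCluster s → IsCluster w → w ⊂ s → ∃[ c ] (Parent c s × w ⊆ c)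
  climb {s} cs = go (⊃-wellFounded _)
    where
    go : ∀ {w} → Acc _ w → IsCluster w → w ⊂ s → ∃[ c ] (Parent c s × w ⊆ c)
    go {w} (acc rec) cw w⊂s with parent-exists cw (⊂⇒∃∉ w⊂s)
    ... | p , w-p@(_ , cp , w⊂p , p-least) with p ≟ˢ s
    ... | yes refl = w , w-p , id
    ... | no p≢s   = let (c , c-s , p⊆c) = go (rec w⊂p) cp (⊆∧≢⇒⊂ (p-least s cs w⊂s) p≢s)
                     in c , c-s , p⊆c ∘ parent-⊆ w-p

  Join : Subset n → Subset n → Subset n → Set
  Join x u J = IsCluster J × x ⊆ J × u ⊆ J × (∀ c → IsCluster c → x ⊆ c → u ⊆ c → J ⊆ c)

  join-exists : ∀ {x} u → IsCluster x → ∃[ J ] Join x u J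
  join-exists {x} u = go (⊃-wellFounded x)
    where
    go : ∀ {x} → Acc _ x → IsCluster x → ∃[ J ] Join x u J
    go {x} (acc rec) cx with u ⊆? x
    ... | yes u⊆x = x , cx , id , u⊆x , λ _ _ x⊆c _ → x⊆c
    ... | no u⊈x with parent-exists cx (≢⊤⇒∃∉ λ x≡⊤ → u⊈x (subst (u ⊆_) (sym x≡⊤) ⊆⊤))
    ... | p , x-p@(_ , cp , x⊂p , p-least) =
      let (J , cJ , p⊆J , u⊆J , J-least) = go (rec x⊂p) cp
      in J , cJ , p⊆J ∘ parent-⊆ x-p , u⊆J ,
         λ c cc x⊆c u⊆c → J-least c cc (p-least c cc (⊆∧≢⇒⊂ x⊆c λ { refl → u⊈x u⊆c })) u⊆c

  child-containing : ∀ {s x} → Proper s → x ∈ s → ∃[ c ] (Parent c s × x ∈ c)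
  child-containing {s} {x} (cs , 1<∣s∣) x∈s =
    let (c , c-s , ⁅x⁆⊆c) = climb cs (⁅⁆-isCluster x) (⊆∧≢⇒⊂ ⁅x⁆⊆s ⁅x⁆≢s) in c , c-s , ⁅x⁆⊆c (x∈⁅x⁆ x)
    where
    ⁅x⁆⊆s : ⁅ x ⁆ ⊆ s
    ⁅x⁆⊆s y∈⁅x⁆ = subst (_∈ s) (sym (x∈⁅y⁆⇒x≡y x y∈⁅x⁆)) x∈s
    ⁅x⁆≢s : ⁅ x ⁆ ≢ s
    ⁅x⁆≢s refl = ℕP.<-irrefl (sym (∣⁅x⁆∣≡1 x)) 1<∣s∣

  module Children {s} (s-proper : Proper s) where
    private
      -- the value ⊤ off s is never used
      childAt : Fin n → Subset n
      childAt x with x ∈? s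
      ... | yes x∈s = proj₁ (child-containing s-proper x∈s)
      ... | no _    = ⊤

      childAt-spec : ∀ {x} → x ∈ s → Parent (childAt x) s × x ∈ childAt x
      childAt-spec {x} x∈s with x ∈? s
      ... | yes x∈s' = proj₂ (child-containing s-proper x∈s')
      ... | no x∉s   = contradiction x∈s x∉s

    abstract
      children : List (Subset n)
      children = deduplicate _≟ˢ_ (map childAt (enumerate s))

      children-unique : Unique children
      children-unique = deduplicate-! _≟ˢ_ _

      ∈-children⇔ : ∀ c → c ∈ₗ children ⇔ Parent c s
      ∈-children⇔ c = mk⇔ ∈⇒parent parent⇒∈
        where
        ∈⇒parent : c ∈ₗ children → Parent c s
        ∈⇒parent c∈ with ∈P.∈-map⁻ childAt (∈P.∈-deduplicate⁻ _≟ˢ_ (map childAt (enumerate s)) c∈)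
        ... | x , x∈ , refl = proj₁ (childAt-spec (to (∈-enumerate s x) x∈))
        parent⇒∈ : Parent c s → c ∈ₗ children
        parent⇒∈ c-s with parent-nonempty c-s
        ... | x , x∈c = ∈P.∈-deduplicate⁺ _≟ˢ_ (subst (_∈ₗ map childAt (enumerate s)) childAt-x≡c
                          (∈P.∈-map⁺ childAt (from (∈-enumerate s x) x∈s)))
          where
          x∈s : x ∈ s
          x∈s = parent-⊆ c-s x∈c
          childAt-x≡c : childAt x ≡ c
          childAt-x≡c = siblings-equal (proj₁ (childAt-spec x∈s)) c-s (proj₂ (childAt-spec x∈s)) x∈c

    ⋃children≡s : ⋃ children ≡ s
    ⋃children≡s = ⊆-antisym
      (λ x∈⋃ → let (c , c∈ , x∈c) = ∈⋃⁻ children x∈⋃ in parent-⊆ (to (∈-children⇔ c) c∈) x∈c)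
      (λ x∈s → ∈⋃⁺ children (from (∈-children⇔ _) (proj₁ (childAt-spec x∈s))) (proj₂ (childAt-spec x∈s)))

    ∣s∣≡sum : ∣ s ∣ ≡ sum (map ∣_∣ children)
    ∣s∣≡sum = trans (cong ∣_∣ (sym ⋃children≡s))
      (∣⋃∣≡sum children children-unique λ c∈ c'∈ c≢c' x∈c x∈c' →
        c≢c' (siblings-equal (to (∈-children⇔ _) c∈) (to (∈-children⇔ _) c'∈) x∈c x∈c'))

    oddChildren : List (Subset n)
    oddChildren = filter (odd? ∣_∣) children

    oddChildren-unique : Unique oddChildren
    oddChildren-unique = UniqueP.filter⁺ (odd? ∣_∣) children-unique

    parity∣s∣≡parity-#oddChildren : ℕ.parity ∣ s ∣ ≡ ℕ.parity (length oddChildren)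
    parity∣s∣≡parity-#oddChildren = trans (cong ℕ.parity ∣s∣≡sum) (parity-sum ∣_∣ children)

    ∈-oddChildren⇔ : ∀ c → c ∈ₗ oddChildren ⇔ (Parent c s × OddC c)
    ∈-oddChildren⇔ c = mk⇔
      (λ c∈ → let (c∈cs , odd) = ∈P.∈-filter⁻ (odd? ∣_∣) {xs = children} c∈
              in to (∈-children⇔ c) c∈cs , from (hasParity⇔ 1ℙ ∣ c ∣) odd)
      (λ (c-s , odd) → ∈P.∈-filter⁺ (odd? ∣_∣) (from (∈-children⇔ c) c-s) (to (hasParity⇔ 1ℙ ∣ c ∣) odd))

    oddChildren-count : ∀ m → OddChildren s m ⇔ m ≡ length oddChildren
    oddChildren-count m = mk⇔
      (λ { (cs , cs-unique , ∈cs⇔ , refl) → unique∧set⇒length≡ cs-unique oddChildren-unique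
         λ c → mk⇔ (from (∈-oddChildren⇔ c) ∘ to (∈cs⇔ c)) (from (∈cs⇔ c) ∘ to (∈-oddChildren⇔ c)) })
      (λ { refl → oddChildren , oddChildren-unique , ∈-oddChildren⇔ , refl })

-- The tree T_C

module ClusterTree {n : ℕ} (ord : Fin n → Fin n → ℚ)
                   (ord-sym : Symmetric ord) (ord-ultra : Ultrametric ord) (2<n : 2 < n) where
  open Clusters ord
  open Trees ord
  open ClusterPicture ord ord-sym ord-ultra

  ⊤-cluster : IsCluster ⊤
  ⊤-cluster = ⊤-isCluster (Fin.fromℕ< (ℕP.<-trans (s≤s z≤n) (ℕP.<-trans (s≤s (s≤s z≤n)) 2<n)))

  ⊤-proper : Proper ⊤
  ⊤-proper = ⊤-cluster , subst (1 <_) (sym (∣⊤∣≡n n)) (ℕP.<-trans (s≤s (s≤s z≤n)) 2<n)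

  ≢⊤⇒⊂⊤ : ∀ {s : Subset n} → s ≢ ⊤ → s ⊂ ⊤
  ≢⊤⇒⊂⊤ = ⊆∧≢⇒⊂ ⊆⊤

  parent⇒≢⊤ : ∀ {c p} → Parent c p → c ≢ ⊤
  parent⇒≢⊤ c-p refl = ⊂⇒⊉ (parent-⊂ c-p) ⊆⊤

  under-⊤-child : ∀ {c} → IsCluster c → c ≢ ⊤ → ∃[ k ] (Parent k ⊤ × c ⊆ k)
  under-⊤-child cc c≢⊤ = climb ⊤-cluster cc (≢⊤⇒⊂⊤ c≢⊤)

  -- a and b are the two children of R = a ∪ b; then v_R is removed and a, b are joined directly
  Halves : Subset n → Subset n → Set
  Halves a b = TwoChildren × Parent a ⊤ × Parent b ⊤ × a ≢ b

  halves-sym : ∀ {a b} → Halves a b → Halves b a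
  halves-sym (two , a-⊤ , b-⊤ , a≢b) = two , b-⊤ , a-⊤ , a≢b ∘ sym

  halves-cover : ∀ {a b k} → Halves a b → Parent k ⊤ → k ≡ a ⊎ k ≡ b
  halves-cover ((_ , _ , _ , _ , _ , only) , a-⊤ , b-⊤ , a≢b) k-⊤
    with only _ a-⊤ | only _ b-⊤ | only _ k-⊤
  ... | inj₁ refl | inj₁ refl | _         = contradiction refl a≢b
  ... | inj₂ refl | inj₂ refl | _         = contradiction refl a≢b
  ... | inj₁ refl | inj₂ refl | k≡s₁      = k≡s₁
  ... | inj₂ refl | inj₁ refl | inj₁ refl = inj₂ refl
  ... | inj₂ refl | inj₁ refl | inj₂ refl = inj₁ refl

  halves-exists : ∀ {a} → TwoChildren → Parent a ⊤ → ∃[ b ] Halves a b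
  halves-exists two@(s₁ , s₂ , s₁-⊤ , s₂-⊤ , s₁≢s₂ , only) a-⊤ with only _ a-⊤
  ... | inj₁ refl = s₂ , two , a-⊤ , s₂-⊤ , s₁≢s₂
  ... | inj₂ refl = s₁ , two , a-⊤ , s₁-⊤ , s₁≢s₂ ∘ sym

  halves-disjoint : ∀ {a b} → Halves a b → Disjoint a b
  halves-disjoint (_ , a-⊤ , b-⊤ , a≢b) x∈a x∈b = a≢b (siblings-equal a-⊤ b-⊤ x∈a x∈b)

  halves-∣∣ : ∀ {a b} → Halves a b → ∣ a ∣ + ∣ b ∣ ≡ n
  halves-∣∣ {a} {b} ab =
    trans (sym (∣p∪q∣≡∣p∣+∣q∣ a b (halves-disjoint ab))) (trans (cong ∣_∣ (⊆-antisym ⊆⊤ ⊤⊆a∪b)) (∣⊤∣≡n n))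
    where
    in-half : ∀ {x k} → x ∈ k → k ≡ a ⊎ k ≡ b → x ∈ a ∪ b
    in-half x∈k (inj₁ refl) = x∈p∪q⁺ (inj₁ x∈k)
    in-half x∈k (inj₂ refl) = x∈p∪q⁺ (inj₂ x∈k)
    ⊤⊆a∪b : ⊤ ⊆ a ∪ b
    ⊤⊆a∪b {x} _ = let (k , k-⊤ , x∈k) = child-containing ⊤-proper (∈⊤ {x = x})
                  in in-half x∈k (halves-cover ab k-⊤)
  module ⊤-children = Children ⊤-proper

  twoChildren⇔length≡2 : TwoChildren ⇔ length ⊤-children.children ≡ 2
  twoChildren⇔length≡2 = mk⇔ to-length from-length
    where
    open ⊤-children
    ∈-pair⇔ : ∀ {a b c : Subset n} → c ∈ₗ (a ∷ b ∷ []) ⇔ (c ≡ a ⊎ c ≡ b)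
    ∈-pair⇔ = mk⇔ (λ { (here c≡a) → inj₁ c≡a ; (there (here c≡b)) → inj₂ c≡b })
                  (λ { (inj₁ c≡a) → here c≡a ; (inj₂ c≡b) → there (here c≡b) })
    to-length : TwoChildren → length children ≡ 2
    to-length (a , b , a-⊤ , b-⊤ , a≢b , only) = sym (unique∧set⇒length≡
      ((a≢b All.∷ All.[]) AllPairs.∷ All.[] AllPairs.∷ AllPairs.[]) children-unique
      λ c → mk⇔ (λ c∈ → from (∈-children⇔ c) (pair-⊤ (to ∈-pair⇔ c∈)))
                (λ c∈ → from ∈-pair⇔ (only c (to (∈-children⇔ c) c∈))))
      where
      pair-⊤ : ∀ {c} → c ≡ a ⊎ c ≡ b → Parent c ⊤
      pair-⊤ (inj₁ refl) = a-⊤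
      pair-⊤ (inj₂ refl) = b-⊤
    from-length : length children ≡ 2 → TwoChildren
    from-length len with children | children-unique | ∈-children⇔
    from-length refl | a ∷ b ∷ [] | (a≢b All.∷ _) AllPairs.∷ _ | ∈⇔ =
      a , b , to (∈⇔ a) (here refl) , to (∈⇔ b) (there (here refl)) , a≢b ,
      λ c c-⊤ → to ∈-pair⇔ (from (∈⇔ c) c-⊤)

  twoChildren? : Dec TwoChildren
  twoChildren? = Dec.map (⇔.sym twoChildren⇔length≡2) (length ⊤-children.children ℕ.≟ 2)

  singleton-or-proper : ∀ {s} → IsCluster s → ∣ s ∣ ≡ 1 ⊎ 1 < ∣ s ∣
  singleton-or-proper ((x , x∈s) , _) with ℕP.m≤n⇒m<n∨m≡n (x∈p⇒0<∣p∣ x∈s)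
  ... | inj₁ 1<∣s∣ = inj₂ 1<∣s∣
  ... | inj₂ 1≡∣s∣ = inj₁ (sym 1≡∣s∣)

  halves⇒bigChild⊎twoProper : ∀ {a b} → Halves a b → BigChild ⊎ TwoProperChildren
  halves⇒bigChild⊎twoProper {a} {b} ab@((_ , _ , _ , _ , _ , only) , a-⊤ , b-⊤ , a≢b)
    with singleton-or-proper (proj₁ a-⊤) | singleton-or-proper (proj₁ b-⊤)
  ... | inj₁ ∣a∣≡1 | _ = inj₁ (b , b-⊤ , subst (λ m → m + ∣ b ∣ ≡ n) ∣a∣≡1 (halves-∣∣ ab))
  ... | inj₂ _ | inj₁ ∣b∣≡1 =
    inj₁ (a , a-⊤ , subst (λ m → m + ∣ a ∣ ≡ n) ∣b∣≡1 (halves-∣∣ (halves-sym ab)))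
  ... | inj₂ 1<∣a∣ | inj₂ 1<∣b∣ =
    inj₂ (a , b , a-⊤ , b-⊤ , a≢b , (proj₁ a-⊤ , 1<∣a∣) , (proj₁ b-⊤ , 1<∣b∣) , λ c c-⊤ → halves-cover ab c-⊤)

  ⊤-children-split : ∀ {c k} → Parent c ⊤ → Parent k ⊤ → (∀ {y} → y ∉ c → y ∈ k) →
                     ∀ d → Parent d ⊤ → d ≡ c ⊎ d ≡ k
  ⊤-children-split {c} {k} c-⊤ k-⊤ ∁c⊆k d d-⊤ = split (y ∈? c)
    where
    y = proj₁ (parent-nonempty d-⊤)
    y∈d = proj₂ (parent-nonempty d-⊤)
    split : Dec (y ∈ c) → d ≡ c ⊎ d ≡ k
    split (yes y∈c) = inj₁ (siblings-equal d-⊤ c-⊤ y∈d y∈c)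
    split (no y∉c)  = inj₂ (siblings-equal d-⊤ k-⊤ y∈d (∁c⊆k y∉c))

  bigChild⇒twoChildren : BigChild → TwoChildren
  bigChild⇒twoChildren (c , c-⊤ , ∣c∣+1≡n) =
    c , k , c-⊤ , k-⊤ , (λ c≡k → x∉c (subst (x ∈_) (sym c≡k) x∈k)) ,
    ⊤-children-split c-⊤ k-⊤ λ y∉c → subst (_∈ k) (sym (suc∣p∣≡n⇒∉-unique ∣c∣+1≡n x∉c y∉c)) x∈k
    where
    x = proj₁ (≢⊤⇒∃∉ (parent⇒≢⊤ c-⊤))
    x∉c = proj₂ (≢⊤⇒∃∉ (parent⇒≢⊤ c-⊤))
    k-spec : ∃[ k ] (Parent k ⊤ × x ∈ k)
    k-spec = child-containing ⊤-proper (∈⊤ {x = x})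
    k = proj₁ k-spec
    k-⊤ = proj₁ (proj₂ k-spec)
    x∈k = proj₂ (proj₂ k-spec)
  twoChildren⇔bigChild⊎twoProper : TwoChildren ⇔ (BigChild ⊎ TwoProperChildren)
  twoChildren⇔bigChild⊎twoProper = mk⇔
    (λ two@(_ , _ , s₁-⊤ , s₂-⊤ , s₁≢s₂ , _) → halves⇒bigChild⊎twoProper (two , s₁-⊤ , s₂-⊤ , s₁≢s₂))
    λ { (inj₁ big) → bigChild⇒twoChildren big
      ; (inj₂ (s₁ , s₂ , s₁-⊤ , s₂-⊤ , s₁≢s₂ , _ , _ , only)) → s₁ , s₂ , s₁-⊤ , s₂-⊤ , s₁≢s₂ , only }

  properTC⇔BYVert : ∀ {v} → ProperTC v ⇔ BYVert v
  properTC⇔BYVert {v} = mk⇔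
    (λ ((cv , not-removed) , not-singleton) →
       (cv , proper cv not-removed not-singleton) ,
       λ (v≡⊤ , removed) → not-removed (v≡⊤ , from twoChildren⇔bigChild⊎twoProper removed))
    (λ ((cv , 1<∣v∣) , not-removed) →
       (cv , λ (v≡⊤ , two) → not-removed (v≡⊤ , to twoChildren⇔bigChild⊎twoProper two)) ,
       λ (_ , ∣v∣≡1) → ℕP.<-irrefl (sym ∣v∣≡1) 1<∣v∣)
    where
    proper : IsCluster v → ¬ (v ≡ ⊤ × TwoChildren) → ¬ TCSing v → 1 < ∣ v ∣
    proper cv not-removed not-singleton with singleton-or-proper cv
    ... | inj₁ ∣v∣≡1  = contradiction ((cv , not-removed) , ∣v∣≡1) not-singleton
    ... | inj₂ 1<∣v∣ = 1<∣v∣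

  proper⇒Proper : ∀ {x} → ProperTC x → Proper x
  proper⇒Proper px = proj₁ (to properTC⇔BYVert px)

  vertex-or-removed : ∀ {v} → IsCluster v → TCVert v ⊎ (v ≡ ⊤ × TwoChildren)
  vertex-or-removed {v} cv with (v ≟ˢ ⊤) ×-dec twoChildren?
  ... | yes removed = inj₂ removed
  ... | no kept     = inj₁ (cv , kept)

  child-vertex : ∀ {w v} → Parent w v → TCVert w
  child-vertex w-v = proj₁ w-v , λ (w≡⊤ , _) → parent⇒≢⊤ w-v w≡⊤

  edge-sym : ∀ {a b} → TCEdge a b → TCEdge b a
  edge-sym (inj₁ (va , vb , inj₁ a-b)) = inj₁ (vb , va , inj₂ a-b)
  edge-sym (inj₁ (va , vb , inj₂ b-a)) = inj₁ (vb , va , inj₁ b-a)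
  edge-sym (inj₂ ab)                   = inj₂ (halves-sym ab)

  edge-vertices : ∀ {a b} → TCEdge a b → TCVert a × TCVert b
  edge-vertices (inj₁ (va , vb , _))     = va , vb
  edge-vertices (inj₂ (_ , a-⊤ , b-⊤ , _)) = child-vertex a-⊤ , child-vertex b-⊤

  -- the neighbour of v towards R, possibly across the joined edge of Halves
  UpNeighbour : Subset n → Subset n → Set
  UpNeighbour v w = (Parent v w × TCVert w) ⊎ Halves v w

  edge⇔ : ∀ {v w} → TCVert v → TCEdge v w ⇔ ((Parent w v × TCVert w) ⊎ UpNeighbour v w)
  edge⇔ vv = mk⇔
    (λ { (inj₁ (_ , vw , inj₁ v-w)) → inj₂ (inj₁ (v-w , vw))
       ; (inj₁ (_ , vw , inj₂ w-v)) → inj₁ (w-v , vw)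
       ; (inj₂ vw)                  → inj₂ (inj₂ vw) })
    (λ { (inj₁ (w-v , vw))        → inj₁ (vv , vw , inj₂ w-v)
       ; (inj₂ (inj₁ (v-w , vw))) → inj₁ (vv , vw , inj₁ v-w)
       ; (inj₂ (inj₂ vw))         → inj₂ vw })

  upNeighbour-⊈ : ∀ {v w} → UpNeighbour v w → ¬ (w ⊆ v)
  upNeighbour-⊈ (inj₁ (v-w , _)) = ⊂⇒⊉ (parent-⊂ v-w)
  upNeighbour-⊈ (inj₂ vw@(_ , _ , w-⊤ , _)) w⊆v =
    let (x , x∈w) = parent-nonempty w-⊤ in halves-disjoint vw (w⊆v x∈w) x∈w

  upNeighbour-vertex : ∀ {v w} → UpNeighbour v w → TCVert w
  upNeighbour-vertex (inj₁ (_ , vw))         = vw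
  upNeighbour-vertex (inj₂ (_ , _ , w-⊤ , _)) = child-vertex w-⊤

  upNeighbour-unique : ∀ {v w w'} → UpNeighbour v w → UpNeighbour v w' → w ≡ w'
  upNeighbour-unique (inj₁ (v-w , _)) (inj₁ (v-w' , _)) = parent-unique v-w v-w'
  upNeighbour-unique (inj₁ (v-w , vw)) (inj₂ (two , v-⊤ , _)) =
    ⊥-elim (proj₂ vw (parent-unique v-w v-⊤ , two))
  upNeighbour-unique (inj₂ (two , v-⊤ , _)) (inj₁ (v-w' , vw')) =
    ⊥-elim (proj₂ vw' (parent-unique v-w' v-⊤ , two))
  upNeighbour-unique (inj₂ vw) (inj₂ vw'@(_ , _ , w'-⊤ , v≢w')) with halves-cover vw w'-⊤
  ... | inj₁ w'≡v = contradiction (sym w'≡v) v≢w'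
  ... | inj₂ w'≡w = sym w'≡w

  upNeighbour-exists : ∀ {v} → TCVert v → v ≢ ⊤ → ∃[ w ] UpNeighbour v w
  upNeighbour-exists (cv , _) v≢⊤ =
    let (p , v-p) = parent-exists cv (≢⊤⇒∃∉ v≢⊤) in from-parent v-p (vertex-or-removed (proj₁ (proj₂ v-p)))
    where
    from-parent : ∀ {v p} → Parent v p → TCVert p ⊎ (p ≡ ⊤ × TwoChildren) → ∃[ w ] UpNeighbour v w
    from-parent v-p (inj₁ vp)           = _ , inj₁ (v-p , vp)
    from-parent v-p (inj₂ (refl , two)) = let (w , vw) = halves-exists two v-p in w , inj₂ vw

  edge-leaving : ∀ {a x y} → IsCluster a → TCEdge x y → x ⊆ a → ¬ (y ⊆ a) → x ≡ a
  edge-leaving {a} {x} ca xy x⊆a y⊈a with x ≟ˢ a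
  ... | yes x≡a = x≡a
  ... | no x≢a with to (edge⇔ (proj₁ (edge-vertices xy))) xy
  ... | inj₁ (y-x , _)                           = ⊥-elim (y⊈a (x⊆a ∘ parent-⊆ y-x))
  ... | inj₂ (inj₁ ((_ , _ , _ , least) , _))     = ⊥-elim (y⊈a (least a ca (⊆∧≢⇒⊂ x⊆a x≢a)))
  ... | inj₂ (inj₂ (_ , (_ , _ , _ , least) , _)) = ⊥-elim (y⊈a (λ _ → least a ca (⊆∧≢⇒⊂ x⊆a x≢a) ∈⊤))

  edge-leaving-to-parent : ∀ {a y v} → TCEdge a y → ¬ (y ⊆ a) → Parent a v → TCVert v → y ≡ v
  edge-leaving-to-parent ay y⊈a a-v vv with to (edge⇔ (proj₁ (edge-vertices ay))) ay
  ... | inj₁ (y-a , _)              = ⊥-elim (y⊈a (parent-⊆ y-a))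
  ... | inj₂ (inj₁ (a-y , _))       = parent-unique a-y a-v
  ... | inj₂ (inj₂ (two , a-⊤ , _)) = ⊥-elim (proj₂ vv (parent-unique a-v a-⊤ , two))

  ⁅⁆-singleton : ∀ x → TCSing ⁅ x ⁆
  ⁅⁆-singleton x = (⁅⁆-isCluster x , λ (⁅x⁆≡⊤ , _) → ℕP.<-irrefl (trans (sym (∣⁅x⁆∣≡1 x)) (size ⁅x⁆≡⊤)) 1<n) ,
                   ∣⁅x⁆∣≡1 x
    where
    1<n : 1 < n
    1<n = ℕP.<-trans (s≤s (s≤s z≤n)) 2<n
    size : ⁅ x ⁆ ≡ ⊤ → ∣ ⁅ x ⁆ ∣ ≡ n
    size ⁅x⁆≡⊤ = trans (cong ∣_∣ ⁅x⁆≡⊤) (∣⊤∣≡n n)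

  singleton⇔ : ∀ {t} → TCSing t ⇔ (∃[ x ] t ≡ ⁅ x ⁆)
  singleton⇔ {t} = mk⇔ (λ (_ , ∣t∣≡1) → ∣p∣≡1⇒≡⁅⁆ t ∣t∣≡1) (λ { (x , refl) → ⁅⁆-singleton x })

  singleton-childless : ∀ {s c} → TCSing s → ¬ Parent c s
  singleton-childless (_ , ∣s∣≡1) c-s =
    let (x , x∈c) = parent-nonempty c-s
    in ℕP.<-irrefl refl (ℕP.<-≤-trans (SubP.p⊂q⇒∣p∣<∣q∣ (parent-⊂ c-s))
                                      (subst (ℕ._≤ _) (sym ∣s∣≡1) (x∈p⇒0<∣p∣ x∈c)))

  singleton-neighbour-unique : ∀ {s t u} → TCSing s → TCEdge t s → TCEdge u s → t ≡ u
  singleton-neighbour-unique ss ts us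
    with to (edge⇔ (proj₁ ss)) (edge-sym ts) | to (edge⇔ (proj₁ ss)) (edge-sym us)
  ... | inj₁ (t-s , _) | _              = ⊥-elim (singleton-childless ss t-s)
  ... | _              | inj₁ (u-s , _) = ⊥-elim (singleton-childless ss u-s)
  ... | inj₂ st        | inj₂ su        = upNeighbour-unique st su

  singleton-neighbour-exists : ∀ {s} → TCSing s → ∃[ u ] (ProperTC u × TCEdge u s)
  singleton-neighbour-exists ss@(vs , ∣s∣≡1) =
    let (w , sw) = upNeighbour-exists vs s≢⊤
    in w , (upNeighbour-vertex sw , not-singleton sw) , edge-sym (from (edge⇔ vs) (inj₂ sw))
    where
    s≢⊤ : _ ≢ ⊤
    s≢⊤ s≡⊤ = ℕP.<-irrefl (trans (sym ∣s∣≡1) (trans (cong ∣_∣ s≡⊤) (∣⊤∣≡n n)))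
                          (ℕP.<-trans (s≤s (s≤s z≤n)) 2<n)
    not-singleton : ∀ {w} → UpNeighbour _ w → ¬ TCSing w
    not-singleton (inj₁ (s-w , _)) (_ , ∣w∣≡1) =
      ℕP.<-irrefl (trans ∣s∣≡1 (sym ∣w∣≡1)) (SubP.p⊂q⇒∣p∣<∣q∣ (parent-⊂ s-w))
    not-singleton (inj₂ sw) (_ , ∣w∣≡1) =
      ℕP.<-irrefl (trans (cong₂ _+_ (sym ∣s∣≡1) (sym ∣w∣≡1)) (halves-∣∣ sw)) 2<n

  module Walks (ρ : Subset n) where
    open Procedure T-C ρ

    _++ʷ_ : ∀ {x y z} → Walk x y → Walk y z → Walk x z
    here _   ++ʷ q = q
    step e p ++ʷ q = step e (p ++ʷ q)

    reverse : ∀ {x y} → Walk x y → Walk y x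
    reverse (here x)       = here x
    reverse (step {x} e p) = reverse p ++ʷ step (edge-sym e) (here x)

    visits-start : ∀ {x y} (p : Walk x y) → Visits x p
    visits-start (here _)   = refl
    visits-start (step _ _) = inj₁ refl

    visits-end : ∀ {x y} (p : Walk x y) → Visits y p
    visits-end (here _)   = refl
    visits-end (step _ p) = inj₂ (visits-end p)

    visits-++ : ∀ {x y z v} (p : Walk x y) (q : Walk y z) → Visits v (p ++ʷ q) → Visits v p ⊎ Visits v q
    visits-++ (here _)   q v∈q          = inj₂ v∈q
    visits-++ (step _ p) q (inj₁ v≡x)   = inj₁ (inj₁ v≡x)
    visits-++ (step _ p) q (inj₂ v∈p++q) = Sum.map₁ inj₂ (visits-++ p q v∈p++q)

    visits-reverse : ∀ {x y v} (p : Walk x y) → Visits v (reverse p) → Visits v p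
    visits-reverse (here _)   v∈ = v∈
    visits-reverse (step e p) v∈ with visits-++ (reverse p) (step (edge-sym e) (here _)) v∈
    ... | inj₁ v∈p        = inj₂ (visits-reverse p v∈p)
    ... | inj₂ (inj₁ v≡y) = inj₂ (subst (λ w → Visits w p) (sym v≡y) (visits-start p))
    ... | inj₂ (inj₂ v≡x) = inj₁ v≡x

    enter : ∀ {a x u} → IsCluster a → (p : Walk x u) → ¬ (x ⊆ a) → u ⊆ a → Visits a p
    enter ca (here _)           x⊈a u⊆a = ⊥-elim (x⊈a u⊆a)
    enter ca (step {y = y} e p) x⊈a u⊆a with y ⊆? _
    ... | yes y⊆a = inj₂ (subst (λ w → Visits w p) (edge-leaving ca (edge-sym e) y⊆a x⊈a) (visits-start p))
    ... | no y⊈a  = inj₂ (enter ca p y⊈a u⊆a)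

    exit-via-parent : ∀ {a v x u} → Parent a v → TCVert v → (p : Walk x u) → x ⊆ a → ¬ (u ⊆ a) → Visits v p
    exit-via-parent a-v vv (here _) x⊆a u⊈a = ⊥-elim (u⊈a x⊆a)
    exit-via-parent {a} a-v vv (step {y = y} e p) x⊆a u⊈a with y ⊆? a
    ... | yes y⊆a = inj₂ (exit-via-parent a-v vv p y⊆a u⊈a)
    ... | no y⊈a  = inj₂ (subst (λ w → Visits w p) y≡v (visits-start p))
      where
      y≡v = edge-leaving-to-parent (subst (λ w → TCEdge w y) (edge-leaving (proj₁ a-v) e x⊆a y⊈a) e) y⊈a a-v vv

    ascent : ∀ {x J} → TCVert x → TCVert J → x ⊆ J → Σ (Walk x J) λ p → ∀ {v} → Visits v p → x ⊆ v × v ⊆ J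
    ascent {J = J} vx vJ = go (⊃-wellFounded _) vx
      where
      go : ∀ {x} → Acc _ x → TCVert x → x ⊆ J → Σ (Walk x J) λ p → ∀ {v} → Visits v p → x ⊆ v × v ⊆ J
      go {x} (acc rec) vx x⊆J with x ≟ˢ J
      ... | yes refl = here x , λ v≡x → ⊆-reflexive (sym v≡x) , ⊆-reflexive v≡x
      ... | no x≢J  = step (inj₁ (vx , vp , inj₁ x-p)) q , visited
        where
        x⊂J = ⊆∧≢⇒⊂ x⊆J x≢J
        p-spec = parent-exists (proj₁ vx) (⊂⇒∃∉ x⊂J)
        p = proj₁ p-spec
        x-p : Parent x p
        x-p = proj₂ p-spec
        p⊆J : p ⊆ J
        p⊆J = proj₂ (proj₂ (proj₂ x-p)) J (proj₁ vJ) x⊂J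
        vp : TCVert p
        vp = proj₁ (proj₂ x-p) , λ (p≡⊤ , two) → proj₂ vJ (⊆-antisym ⊆⊤ (subst (_⊆ J) p≡⊤ p⊆J) , two)
        rest = go (rec (parent-⊂ x-p)) vp p⊆J
        q = proj₁ rest
        visited : ∀ {v} → Visits v (step (inj₁ (vx , vp , inj₁ x-p)) q) → x ⊆ v × v ⊆ J
        visited (inj₁ v≡x) = ⊆-reflexive (sym v≡x) , subst (_⊆ J) (sym v≡x) x⊆J
        visited (inj₂ v∈q) = let (p⊆v , v⊆J) = proj₂ rest v∈q in p⊆v ∘ parent-⊆ x-p , v⊆J

    Between : Subset n → Subset n → Subset n → Set
    Between x u v = (x ⊆ v ⊎ u ⊆ v) × (∀ c → IsCluster c → x ⊆ c → u ⊆ c → v ⊆ c)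

    PathBetween : Subset n → Subset n → Set
    PathBetween x u = Σ (Walk x u) λ p → ∀ {v} → Visits v p → Between x u v

    path-through-join : ∀ {x u J} → TCVert x → TCVert u → TCVert J → Join x u J → PathBetween x u
    path-through-join {x} {u} {J} vx vu vJ (_ , x⊆J , u⊆J , J-least) = q₁ ++ʷ reverse q₂ , visited
      where
      up₁ = ascent vx vJ x⊆J
      up₂ = ascent vu vJ u⊆J
      q₁ = proj₁ up₁
      q₂ = proj₁ up₂
      below-J : ∀ {v} → v ⊆ J → ∀ c → IsCluster c → x ⊆ c → u ⊆ c → v ⊆ c
      below-J v⊆J c cc x⊆c u⊆c = ⊆-trans v⊆J (J-least c cc x⊆c u⊆c)
      on-either-side : ∀ {v} → Visits v q₁ ⊎ Visits v (reverse q₂) → Between x u v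
      on-either-side (inj₁ v∈q₁) = inj₁ (proj₁ (proj₂ up₁ v∈q₁)) , below-J (proj₂ (proj₂ up₁ v∈q₁))
      on-either-side (inj₂ v∈q₂) =
        let (u⊆v , v⊆J) = proj₂ up₂ (visits-reverse q₂ v∈q₂) in inj₂ u⊆v , below-J v⊆J
      visited : ∀ {v} → Visits v (q₁ ++ʷ reverse q₂) → Between x u v
      visited v∈ = on-either-side (visits-++ q₁ (reverse q₂) v∈)

    path-across-halves : ∀ {x u} → TCVert x → TCVert u → TwoChildren → Join x u ⊤ → PathBetween x u
    path-across-halves {x} {u} vx vu two (_ , _ , _ , ⊤-least) = q₁ ++ʷ step (inj₂ k₁k₂) (reverse q₂) , visited
      where
      half : ∀ {w} → TCVert w → ∃[ k ] (Parent k ⊤ × w ⊆ k)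
      half (cw , kept) = under-⊤-child cw (λ w≡⊤ → kept (w≡⊤ , two))
      k₁ = proj₁ (half vx)
      k₂ = proj₁ (half vu)
      k₁-⊤ = proj₁ (proj₂ (half vx))
      k₂-⊤ = proj₁ (proj₂ (half vu))
      x⊆k₁ = proj₂ (proj₂ (half vx))
      u⊆k₂ = proj₂ (proj₂ (half vu))
      k₁≢k₂ : k₁ ≢ k₂
      k₁≢k₂ k₁≡k₂ = ⊂⇒⊉ (parent-⊂ k₁-⊤) (⊤-least k₁ (proj₁ k₁-⊤) x⊆k₁ (subst (u ⊆_) (sym k₁≡k₂) u⊆k₂))
      k₁k₂ : Halves k₁ k₂
      k₁k₂ = two , k₁-⊤ , k₂-⊤ , k₁≢k₂
      up₁ = ascent vx (child-vertex k₁-⊤) x⊆k₁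
      up₂ = ascent vu (child-vertex k₂-⊤) u⊆k₂
      q₁ = proj₁ up₁
      q₂ = proj₁ up₂
      contains-x-or-u : ∀ {v} → Visits v q₁ ⊎ Visits v (step (inj₂ k₁k₂) (reverse q₂)) → x ⊆ v ⊎ u ⊆ v
      contains-x-or-u (inj₁ v∈q₁)        = inj₁ (proj₁ (proj₂ up₁ v∈q₁))
      contains-x-or-u (inj₂ (inj₁ v≡k₁)) = inj₁ (subst (x ⊆_) (sym v≡k₁) x⊆k₁)
      contains-x-or-u (inj₂ (inj₂ v∈q₂)) = inj₂ (proj₁ (proj₂ up₂ (visits-reverse q₂ v∈q₂)))
      visited : ∀ {v} → Visits v (q₁ ++ʷ step (inj₂ k₁k₂) (reverse q₂)) → Between x u v
      visited v∈ = contains-x-or-u (visits-++ q₁ _ v∈) , λ c cc x⊆c u⊆c _ → ⊤-least c cc x⊆c u⊆c ∈⊤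

    path : ∀ {x u} → TCVert x → TCVert u → PathBetween x u
    path {x} {u} vx vu = through (vertex-or-removed (proj₁ (proj₂ (join-exists u (proj₁ vx)))))
                                 (proj₂ (join-exists u (proj₁ vx)))
      where
      through : ∀ {J} → TCVert J ⊎ (J ≡ ⊤ × TwoChildren) → Join x u J → PathBetween x u
      through (inj₁ vJ)          join = path-through-join vx vu vJ join
      through (inj₂ (refl , two)) join = path-across-halves vx vu two join

    last-edge : ∀ {x y s} (e : TCEdge x y) (r : Walk y s) →
                ∃[ t ] Σ (Walk x t) λ q → TCEdge t s × (∀ {v} → Visits v q → Visits v (step e r))
    last-edge {x} e (here _)    = x , here x , e , inj₁
    last-edge     e (step e' r) =
      let (t , q , ts , q⊆r) = last-edge e' r
      in t , step e q , ts , λ { (inj₁ v≡x) → inj₁ v≡x ; (inj₂ v∈q) → inj₂ (q⊆r v∈q) }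

-- T_C rooted at a proper vertex

module Rooted {n : ℕ} (ord : Fin n → Fin n → ℚ) (ord-sym : Symmetric ord) (ord-ultra : Ultrametric ord)
              (2<n : 2 < n) (n-even : ℕ.parity n ≡ 0ℙ)
              (ρ : Subset n) (ρ-proper : Trees.ProperTC ord ρ) where
  open Clusters ord
  open Trees ord
  open ClusterPicture ord ord-sym ord-ultra
  open ClusterTree ord ord-sym ord-ultra 2<n
  open Procedure T-C ρ
  open Walks ρ

  ρ-vertex : TCVert ρ
  ρ-vertex = proj₁ ρ-proper

  ρ-cluster : IsCluster ρ
  ρ-cluster = proj₁ ρ-vertex

  ρ-point : ∃[ x ] x ∈ ρ
  ρ-point = proj₁ ρ-cluster

  data Position (v : Subset n) : Set where
    outside : ¬ (ρ ⊆ v) → Position v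
    at      : ρ ≡ v → Position v
    above   : ∀ {c} → Parent c v → ρ ⊆ c → Position v

  position : ∀ {v} → IsCluster v → Position v
  position {v} cv with ρ ⊆? v
  ... | no ρ⊈v  = outside ρ⊈v
  ... | yes ρ⊆v with ρ ≟ˢ v
  ... | yes ρ≡v = at ρ≡v
  ... | no ρ≢v  = let (c , c-v , ρ⊆c) = climb cv ρ-cluster (⊆∧≢⇒⊂ ρ⊆v ρ≢v) in above c-v ρ⊆c

  desc-outside : ∀ {v u} → TCVert v → ¬ (ρ ⊆ v) → TCVert u → Desc v u ⇔ u ⊆ v
  desc-outside {v} {u} vv ρ⊈v vu = mk⇔ {A = Desc v u} {B = u ⊆ v}
    (λ desc → let (p , on-path) = path ρ-vertex vu in u-below (proj₁ (on-path (desc p))))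
    (λ (u⊆v : u ⊆ v) p → enter (proj₁ vv) p ρ⊈v u⊆v)
    where
    u-below : ρ ⊆ v ⊎ u ⊆ v → u ⊆ v
    u-below (inj₁ ρ⊆v) = ⊥-elim (ρ⊈v ρ⊆v)
    u-below (inj₂ u⊆v) x∈u = u⊆v x∈u

  desc-at : ∀ {v u} → ρ ≡ v → Desc v u
  desc-at ρ≡v p = subst (λ w → Visits w p) ρ≡v (visits-start p)

  desc-above : ∀ {v c u} → TCVert v → Parent c v → ρ ⊆ c → TCVert u → Desc v u ⇔ (¬ (u ⊆ c))
  desc-above {v} {c} {u} vv c-v ρ⊆c vu = mk⇔ {A = Desc v u} {B = ¬ (u ⊆ c)}
    (λ desc (u⊆c : u ⊆ c) → let (p , on-path) = path ρ-vertex vu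
                            in ⊂⇒⊉ (parent-⊂ c-v) (proj₂ (on-path (desc p)) c (proj₁ c-v) ρ⊆c u⊆c))
    (λ u⊈c p → exit-via-parent c-v vv p ρ⊆c u⊈c)

  proper≢singleton : ∀ {v s} → ProperV v → TCSing s → v ≢ s
  proper≢singleton (_ , not-singleton) ss refl = not-singleton ss

  desc-singleton : ∀ {v s} → ProperV v → TCSing s → Desc v s ⇔ (∃[ u ] (ProperV u × Desc v u × TCEdge u s))
  desc-singleton {v} {s} pv ss = mk⇔ via-neighbour from-neighbour
    where
    via-neighbour : Desc v s → ∃[ u ] (ProperV u × Desc v u × TCEdge u s)
    via-neighbour desc =
      let (u , pu , us) = singleton-neighbour-exists ss
          desc-u : Desc v u
          desc-u q = last-step q (visits-++ q (step us (here s)) (desc (q ++ʷ step us (here s))))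
      in u , pu , desc-u , us
      where
      last-step : ∀ {u} (q : Walk ρ u) → Visits v q ⊎ (v ≡ u ⊎ v ≡ s) → Visits v q
      last-step q (inj₁ v∈q)        = v∈q
      last-step q (inj₂ (inj₁ v≡u)) = subst (λ w → Visits w q) (sym v≡u) (visits-end q)
      last-step q (inj₂ (inj₂ v≡s)) = ⊥-elim (proper≢singleton pv ss v≡s)
    from-neighbour : ∃[ u ] (ProperV u × Desc v u × TCEdge u s) → Desc v s
    from-neighbour (u , _ , desc-u , us) (here _)   = ⊥-elim (proper≢singleton ρ-proper ss refl)
    from-neighbour (u , _ , desc-u , us) (step e r) =
      let (t , q , ts , q⊆p) = last-edge e r
      in q⊆p (subst (λ w → (q : Walk ρ w) → Visits v q) (singleton-neighbour-unique ss us ts) desc-u q)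

  size⇔ : ∀ {v} → ProperV v → (Q : Subset n) → (∀ x → Desc v ⁅ x ⁆ ⇔ x ∈ Q) → ∀ k → Size v k ⇔ k ≡ ∣ Q ∣
  size⇔ {v} pv Q desc⇔ k = mk⇔
    (λ { (ss , ss-unique , ∈ss , refl) →
           unique∧image⇒length≡∣∣ ⁅⁆-injective ss-unique λ t → ⇔.trans (∈ss t) (counted⇔ t) })
    (λ { refl → map ⁅_⁆ (enumerate Q) , ⁅Q⁆-unique ,
                (λ t → ⇔.trans (∈-map-enumerate ⁅_⁆ Q t) (⇔.sym (counted⇔ t))) ,
                unique∧image⇒length≡∣∣ ⁅⁆-injective ⁅Q⁆-unique (∈-map-enumerate ⁅_⁆ Q) })
    where
    ⁅Q⁆-unique = map-enumerate-unique ⁅⁆-injective Q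
    counted⇔ : ∀ t → (TCSing t × ∃[ u ] (ProperV u × Desc v u × TCEdge u t)) ⇔ Image ⁅_⁆ Q t
    counted⇔ t = mk⇔
      (λ (st , below) → let (x , t≡⁅x⁆) = to singleton⇔ st
                        in x , t≡⁅x⁆ , to (desc⇔ x) (subst (Desc v) t≡⁅x⁆ (from (desc-singleton pv st) below)))
      (λ { (x , refl , x∈Q) → ⁅⁆-singleton x , to (desc-singleton pv (⁅⁆-singleton x)) (from (desc⇔ x) x∈Q) })

  size-outside : ∀ {v} → ProperV v → ¬ (ρ ⊆ v) → ∀ k → Size v k ⇔ k ≡ ∣ v ∣
  size-outside {v} pv ρ⊈v = size⇔ pv v λ x →
    ⇔.trans (desc-outside (proj₁ pv) ρ⊈v (proj₁ (⁅⁆-singleton x))) ⁅x⁆⊆p⇔x∈p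

  size-at : ∀ {v} → ProperV v → ρ ≡ v → ∀ k → Size v k ⇔ k ≡ ∣ ⊤ {n} ∣
  size-at pv ρ≡v = size⇔ pv ⊤ λ x → mk⇔ (λ _ → ∈⊤) (λ _ → desc-at ρ≡v)

  size-above : ∀ {v c} → ProperV v → Parent c v → ρ ⊆ c → ∀ k → Size v k ⇔ k ≡ ∣ ∁ c ∣
  size-above {v} {c} pv c-v ρ⊆c = size⇔ pv (∁ c) λ x →
    ⇔.trans (desc-above (proj₁ pv) c-v ρ⊆c (proj₁ (⁅⁆-singleton x)))
            (mk⇔ (λ ⁅x⁆⊈c → x∉p⇒x∈∁p (⁅x⁆⊈c ∘ from ⁅x⁆⊆p⇔x∈p))
                 (λ x∈∁c → x∈∁p⇒x∉p x∈∁c ∘ to ⁅x⁆⊆p⇔x∈p))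

  HasParityV : Parity → Subset n → Set
  HasParityV 0ℙ = EvenV
  HasParityV 1ℙ = OddV

  RootedParity : Subset n → Parity → Set
  RootedParity w p = ∀ q → HasParityV q w ⇔ p ≡ q

  rootedParity-of-size : ∀ {v m} → ProperV v → (∀ k → Size v k ⇔ k ≡ m) → RootedParity v (ℕ.parity m)
  rootedParity-of-size {v} {m} pv size 0ℙ = mk⇔
    (λ (_ , k , sk , 2∣k) → to (hasParity⇔ 0ℙ m) (subst (HasParity 0ℙ) (to (size k) sk) 2∣k))
    (λ even → pv , m , from (size m) refl , from (hasParity⇔ 0ℙ m) even)
  rootedParity-of-size {v} {m} pv size 1ℙ = mk⇔
    (λ { (inj₁ (_ , sv)) → ⊥-elim (proj₂ pv sv)
       ; (inj₂ (_ , k , sk , odd)) → to (hasParity⇔ 1ℙ m) (subst (HasParity 1ℙ) (to (size k) sk) odd) })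
    (λ odd → inj₂ (pv , m , from (size m) refl , from (hasParity⇔ 1ℙ m) odd))

  rootedParity-singleton : ∀ {w} → TCSing w → RootedParity w 1ℙ
  rootedParity-singleton sw 0ℙ = mk⇔ (λ ((_ , not-singleton) , _) → ⊥-elim (not-singleton sw)) (λ ())
  rootedParity-singleton sw 1ℙ = mk⇔ (λ _ → refl) (λ _ → inj₁ (proj₁ sw , sw))

  parity-∁ : ∀ (c : Subset n) → ℕ.parity ∣ ∁ c ∣ ≡ ℕ.parity ∣ c ∣
  parity-∁ c = trans (cong ℕ.parity (∣∁p∣≡n∸∣p∣ c)) (parity[m∸k]≡parity[k] n-even (SubP.∣p∣≤n c))

  halves-parity : ∀ {a b} → Halves a b → ℕ.parity ∣ b ∣ ≡ ℕ.parity ∣ a ∣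
  halves-parity {a} {b} ab =
    trans (cong ℕ.parity (sym (trans (cong (_∸ ∣ a ∣) (sym (halves-∣∣ ab))) (ℕP.m+n∸m≡n ∣ a ∣ ∣ b ∣))))
          (parity[m∸k]≡parity[k] n-even (SubP.∣p∣≤n a))

  rootedParity-below : ∀ {w} → TCVert w → ¬ (ρ ⊆ w) → RootedParity w (ℕ.parity ∣ w ∣)
  rootedParity-below {w} vw ρ⊈w = by-size (singleton-or-proper (proj₁ vw))
    where
    by-size : ∣ w ∣ ≡ 1 ⊎ 1 < ∣ w ∣ → RootedParity w (ℕ.parity ∣ w ∣)
    by-size (inj₁ ∣w∣≡1) =
      subst (RootedParity w) (cong ℕ.parity (sym ∣w∣≡1)) (rootedParity-singleton (vw , ∣w∣≡1))
    by-size (inj₂ 1<∣w∣) = rootedParity-of-size pw (size-outside pw ρ⊈w)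
      where pw = vw , λ (_ , ∣w∣≡1) → ℕP.<-irrefl (sym ∣w∣≡1) 1<∣w∣

  rootedParity-at : ∀ {v} → ProperV v → ρ ≡ v → RootedParity v 0ℙ
  rootedParity-at pv ρ≡v =
    subst (RootedParity _) (trans (cong ℕ.parity (∣⊤∣≡n n)) n-even) (rootedParity-of-size pv (size-at pv ρ≡v))

  rootedParity-above : ∀ {v c} → ProperV v → Parent c v → ρ ⊆ c → RootedParity v (ℕ.parity ∣ c ∣)
  rootedParity-above {c = c} pv c-v ρ⊆c =
    subst (RootedParity _) (parity-∁ c) (rootedParity-of-size pv (size-above pv c-v ρ⊆c))

  parent-proper : ∀ {c v} → Parent c v → TCVert v → ProperV v
  parent-proper {c} c-v vv = vv , λ (_ , ∣v∣≡1) → singleton-childless (vv , ∣v∣≡1) c-v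

  rootedParity-up : ∀ {v w} → ρ ⊆ v → UpNeighbour v w → RootedParity w (ℕ.parity ∣ v ∣)
  rootedParity-up ρ⊆v (inj₁ (v-w , vw)) = rootedParity-above (parent-proper v-w vw) v-w ρ⊆v
  rootedParity-up {v} {w} ρ⊆v (inj₂ vw@(_ , _ , w-⊤ , _)) =
    subst (RootedParity w) (halves-parity vw) (rootedParity-below (child-vertex w-⊤) ρ⊈w)
    where
    ρ⊈w : ¬ (ρ ⊆ w)
    ρ⊈w ρ⊆w = let (x , x∈ρ) = ρ-point in halves-disjoint vw (ρ⊆v x∈ρ) (ρ⊆w x∈ρ)

  siblings-containing-ρ : ∀ {v w c} → Parent w v → Parent c v → ρ ⊆ w → ρ ⊆ c → w ≡ c
  siblings-containing-ρ w-v c-v ρ⊆w ρ⊆c = let (x , x∈ρ) = ρ-point in siblings-equal w-v c-v (ρ⊆w x∈ρ) (ρ⊆c x∈ρ)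

  child-down : ∀ {v w} → TCVert v → Parent w v → Desc v w ⇔ (¬ (ρ ⊆ w))
  child-down {v} {w} vv w-v = by (position (proj₁ vv))
    where
    vw = child-vertex w-v
    by : Position v → Desc v w ⇔ (¬ (ρ ⊆ w))
    by (outside ρ⊈v) = mk⇔ (λ _ (ρ⊆w : ρ ⊆ w) → ρ⊈v (⊆-trans ρ⊆w (parent-⊆ w-v)))
                          (λ _ → from (desc-outside vv ρ⊈v vw) (parent-⊆ w-v))
    by (at ρ≡v)      = mk⇔ (λ _ (ρ⊆w : ρ ⊆ w) → ⊂⇒⊉ (parent-⊂ w-v) (subst (_⊆ w) ρ≡v ρ⊆w)) (λ _ → desc-at ρ≡v)
    by (above {c} c-v ρ⊆c) = ⇔.trans (desc-above vv c-v ρ⊆c vw) (mk⇔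
      (λ w⊈c (ρ⊆w : ρ ⊆ w) → w⊈c (⊆-reflexive (siblings-containing-ρ w-v c-v ρ⊆w ρ⊆c)))
      (λ ρ⊈w (w⊆c : w ⊆ _) → ρ⊈w (subst (ρ ⊆_) (sym (sibling-⊆⇒≡ w-v c-v w⊆c)) ρ⊆c)))

  child-up : ∀ {v w} → TCVert v → UpNeighbour v w → Desc v w ⇔ ρ ⊆ v
  child-up {v} {w} vv vw = by (position (proj₁ vv))
    where
    by : Position v → Desc v w ⇔ ρ ⊆ v
    by (outside ρ⊈v) = mk⇔ {B = ρ ⊆ v}
      (λ desc → ⊥-elim (upNeighbour-⊈ vw (to (desc-outside vv ρ⊈v (upNeighbour-vertex vw)) desc)))
      (λ ρ⊆v → ⊥-elim (ρ⊈v ρ⊆v))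
    by (at ρ≡v) = mk⇔ {B = ρ ⊆ v} (λ _ → ⊆-reflexive ρ≡v) (λ _ → desc-at ρ≡v)
    by (above c-v ρ⊆c) = mk⇔ {B = ρ ⊆ v} (λ _ → ⊆-trans ρ⊆c (parent-⊆ c-v))
      (λ _ → from (desc-above vv c-v ρ⊆c (upNeighbour-vertex vw))
                  λ w⊆c → upNeighbour-⊈ vw (⊆-trans w⊆c (parent-⊆ c-v)))

  child⇔ : ∀ {v w} → TCVert v → Child v w ⇔ ((Parent w v × ¬ (ρ ⊆ w)) ⊎ (UpNeighbour v w × ρ ⊆ v))
  child⇔ {v} {w} vv = mk⇔
    (λ (e , desc) → by-edge desc (to (edge⇔ vv) e))
    (λ { (inj₁ (w-v , ρ⊈w)) → from (edge⇔ vv) (inj₁ (w-v , child-vertex w-v)) , from (child-down vv w-v) ρ⊈w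
       ; (inj₂ (vw , ρ⊆v))   → from (edge⇔ vv) (inj₂ vw) , from (child-up vv vw) ρ⊆v })
    where
    by-edge : Desc v w → (Parent w v × TCVert w) ⊎ UpNeighbour v w →
              (Parent w v × ¬ (ρ ⊆ w)) ⊎ (UpNeighbour v w × ρ ⊆ v)
    by-edge desc (inj₁ (w-v , _)) = inj₁ (w-v , to (child-down vv w-v) desc)
    by-edge desc (inj₂ vw)        = inj₂ (vw , to (child-up vv vw) desc)

  TerminalParity : Subset n → Subset n → Parity → Set
  TerminalParity x y p = (Child x y × RootedParity y p × ¬ Child y x) ⊎
                         (Child y x × RootedParity x p × ¬ Child x y)

  orientation : ∀ {x y} → TCVert x → UpNeighbour x y → TerminalParity x y (ℕ.parity ∣ x ∣)
  orientation {x} {y} vx xy = by (ρ ⊆? x)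
    where
    vy = upNeighbour-vertex xy
    by : Dec (ρ ⊆ x) → TerminalParity x y (ℕ.parity ∣ x ∣)
    by (yes ρ⊆x) =
      inj₁ (from (child⇔ vx) (inj₂ (xy , ρ⊆x)) , rootedParity-up ρ⊆x xy , not-back ∘ to (child⇔ vy))
      where
      not-back : ¬ ((Parent x y × ¬ (ρ ⊆ x)) ⊎ (UpNeighbour y x × ρ ⊆ y))
      not-back (inj₁ (_ , ρ⊈x))  = ρ⊈x ρ⊆x
      not-back (inj₂ (yx , ρ⊆y)) = let (z , z∈ρ) = ρ-point in
        Sum.[ upNeighbour-⊈ yx , upNeighbour-⊈ xy ] (clusters-nest (proj₁ vx) (proj₁ vy) (ρ⊆x z∈ρ) (ρ⊆y z∈ρ))
    by (no ρ⊈x) =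
      inj₂ (from (child⇔ vy) (towards xy) , rootedParity-below vx ρ⊈x , not-forth ∘ to (child⇔ vx))
      where
      ρ-side : ∀ {k} → ρ ⊆ k → k ≡ x ⊎ k ≡ y → ρ ⊆ y
      ρ-side ρ⊆k (inj₁ refl) = ⊥-elim (ρ⊈x ρ⊆k)
      ρ-side ρ⊆k (inj₂ refl) = ρ⊆k
      towards : UpNeighbour x y → (Parent x y × ¬ (ρ ⊆ x)) ⊎ (UpNeighbour y x × ρ ⊆ y)
      towards (inj₁ (x-y , _)) = inj₁ (x-y , ρ⊈x)
      towards (inj₂ xy@(two , _)) =
        let (k , k-⊤ , ρ⊆k) = under-⊤-child ρ-cluster (λ ρ≡⊤ → proj₂ ρ-vertex (ρ≡⊤ , two))
        in inj₂ (inj₂ (halves-sym xy) , ρ-side ρ⊆k (halves-cover xy k-⊤))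
      not-forth : ¬ ((Parent y x × ¬ (ρ ⊆ y)) ⊎ (UpNeighbour x y × ρ ⊆ x))
      not-forth (inj₁ (y-x , _)) = upNeighbour-⊈ xy (parent-⊆ y-x)
      not-forth (inj₂ (_ , ρ⊆x)) = ρ⊈x ρ⊆x

  terminalParity-colour : ∀ {x y p} c → TerminalParity x y p →
                          ((Child x y × HasParityV c y) ⊎ (Child y x × HasParityV c x)) ⇔ p ≡ c
  terminalParity-colour c (inj₁ (x→y , parity-y , not-back)) = mk⇔
    (λ { (inj₁ (_ , has)) → to (parity-y c) has ; (inj₂ (y→x , _)) → ⊥-elim (not-back y→x) })
    (λ p≡c → inj₁ (x→y , from (parity-y c) p≡c))
  terminalParity-colour c (inj₂ (y→x , parity-x , not-forth)) = mk⇔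
    (λ { (inj₂ (_ , has)) → to (parity-x c) has ; (inj₁ (x→y , _)) → ⊥-elim (not-forth x→y) })
    (λ p≡c → inj₂ (y→x , from (parity-x c) p≡c))

  HasParityC : Parity → Subset n → Set
  HasParityC c s = HasParity c ∣ s ∣

  LengthView : Subset n → Subset n → ℚ → Set
  LengthView x y L = (Parent x y × Delta x L) ⊎ (Parent y x × Delta y L) ⊎
                     (Halves x y × ∃[ δx ] ∃[ δy ] (Delta x δx × Delta y δy × L ≡ δx ℚ.+ δy))

  length-view : ∀ {x y L} → ProperV x → ProperV y → TCLen x y L ⇔ LengthView x y L
  length-view px py = mk⇔
    (λ { (inj₁ (_ , _ , _ , _ , inj₁ down)) → inj₁ down
       ; (inj₁ (_ , _ , _ , _ , inj₂ up))   → inj₂ (inj₁ up)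
       ; (inj₂ (two , x-⊤ , y-⊤ , x≢y , _ , _ , sum)) → inj₂ (inj₂ ((two , x-⊤ , y-⊤ , x≢y) , sum)) })
    (λ { (inj₁ down)        → inj₁ (proj₁ px , proj₁ py , proper⇒Proper px , proper⇒Proper py , inj₁ down)
       ; (inj₂ (inj₁ up))   → inj₁ (proj₁ px , proj₁ py , proper⇒Proper px , proper⇒Proper py , inj₂ up)
       ; (inj₂ (inj₂ ((two , x-⊤ , y-⊤ , x≢y) , sum))) →
           inj₂ (two , x-⊤ , y-⊤ , x≢y , proper⇒Proper px , proper⇒Proper py , sum) })

  -- c = 0ℙ with doubled lengths gives the yellow edges, c = 1ℙ with lengths as they are the blue ones
  module EdgeColour (c : Parity) (scale : ℚ → ℚ) (scale-+ : ∀ a b → scale (a ℚ.+ b) ≡ scale a ℚ.+ scale b)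
                    (EdgeLength : Subset n → ℚ → Set)
                    (edgeLength⇔ : ∀ {s ℓ} → EdgeLength s ℓ ⇔ (∃[ δ ] (Delta s δ × ℓ ≡ scale δ)))
                    where

    ColourV : Subset n → Subset n → Set
    ColourV x y = (Child x y × HasParityV c y) ⊎ (Child y x × HasParityV c x)

    RootedEdge : Subset n → Subset n → ℚ → Set
    RootedEdge x y ℓ = ProperV x × ProperV y × TCEdge x y × ColourV x y × ∃[ L ] (TCLen x y L × ℓ ≡ scale L)

    DirEdge : Subset n → Subset n → ℚ → Set
    DirEdge s p ℓ = BYVert s × BYVert p × Parent s p × HasParityC c s × EdgeLength s ℓ

    ClusterEdge : Subset n → Subset n → ℚ → Set
    ClusterEdge x y ℓ = DirEdge x y ℓ ⊎ DirEdge y x ℓ ⊎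
      (Merged x y × HasParityC c x × HasParityC c y ×
       ∃[ δx ] ∃[ δy ] (Delta x δx × Delta y δy × ℓ ≡ scale δx ℚ.+ scale δy))

    colour-up : ∀ {x y} → TCVert x → UpNeighbour x y → ColourV x y ⇔ HasParityC c x
    colour-up {x} vx xy = ⇔.trans (terminalParity-colour c (orientation vx xy)) (⇔.sym (hasParity⇔ c ∣ x ∣))

    colourV-sym : ∀ {x y} → ColourV x y ⇔ ColourV y x
    colourV-sym = mk⇔ Sum.swap Sum.swap

    rooted⇒cluster : ∀ {x y ℓ} → ProperV x → ProperV y → RootedEdge x y ℓ → ClusterEdge x y ℓ
    rooted⇒cluster {x} {y} {ℓ} px py (_ , _ , _ , colour , L , len , ℓ≡) = by-view (to (length-view px py) len)
      where
      vx = proj₁ px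
      vy = proj₁ py
      by-view : LengthView x y L → ClusterEdge x y ℓ
      by-view (inj₁ (x-y , δx)) =
        inj₁ (to properTC⇔BYVert px , to properTC⇔BYVert py , x-y ,
              to (colour-up vx (inj₁ (x-y , vy))) colour , from edgeLength⇔ (L , δx , ℓ≡))
      by-view (inj₂ (inj₁ (y-x , δy))) =
        inj₂ (inj₁ (to properTC⇔BYVert py , to properTC⇔BYVert px , y-x ,
                    to (colour-up vy (inj₁ (y-x , vx))) (to colourV-sym colour) ,
                    from edgeLength⇔ (L , δy , ℓ≡)))
      by-view (inj₂ (inj₂ (xy@(two , x-⊤ , y-⊤ , x≢y) , δx , δy , dx , dy , L≡))) =
        inj₂ (inj₂ ((two-proper , x-⊤ , y-⊤ , x≢y) , has-x , has-y , δx , δy , dx , dy ,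
                    trans ℓ≡ (trans (cong scale L≡) (scale-+ δx δy))))
        where
        has-x = to (colour-up vx (inj₂ xy)) colour
        has-y : HasParityC c y
        has-y = from (hasParity⇔ c ∣ y ∣) (trans (halves-parity xy) (to (hasParity⇔ c ∣ x ∣) has-x))
        two-proper : TwoProperChildren
        two-proper = x , y , x-⊤ , y-⊤ , x≢y , proper⇒Proper px , proper⇒Proper py ,
                     λ k k-⊤ → halves-cover xy k-⊤

    cluster⇒rooted : ∀ {x y ℓ} → ProperV x → ProperV y → ClusterEdge x y ℓ → RootedEdge x y ℓ
    cluster⇒rooted px@(vx , _) py@(vy , _) (inj₁ (_ , _ , x-y , has , len)) =
      let (δ , δx , ℓ≡) = to edgeLength⇔ len in
      px , py , inj₁ (vx , vy , inj₁ x-y) , from (colour-up vx (inj₁ (x-y , vy))) has ,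
      δ , from (length-view px py) (inj₁ (x-y , δx)) , ℓ≡
    cluster⇒rooted px@(vx , _) py@(vy , _) (inj₂ (inj₁ (_ , _ , y-x , has , len))) =
      let (δ , δy , ℓ≡) = to edgeLength⇔ len in
      px , py , inj₁ (vx , vy , inj₂ y-x) , from colourV-sym (from (colour-up vy (inj₁ (y-x , vx))) has) ,
      δ , from (length-view px py) (inj₂ (inj₁ (y-x , δy))) , ℓ≡
    cluster⇒rooted px@(vx , _) py
                   (inj₂ (inj₂ ((two-proper , x-⊤ , y-⊤ , x≢y) , has-x , _ , δx , δy , dx , dy , ℓ≡))) =
      let xy = from twoChildren⇔bigChild⊎twoProper (inj₂ two-proper) , x-⊤ , y-⊤ , x≢y in
      px , py , inj₂ xy , from (colour-up vx (inj₂ xy)) has-x ,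
      δx ℚ.+ δy , from (length-view px py) (inj₂ (inj₂ (xy , δx , δy , dx , dy , refl))) ,
      trans ℓ≡ (sym (scale-+ δx δy))

    edge-iso : ∀ {x y ℓ} → ProperV x → ProperV y → RootedEdge x y ℓ ⇔ ClusterEdge x y ℓ
    edge-iso px py = mk⇔ (rooted⇒cluster px py) (cluster⇒rooted px py)

  evenC⇔ : ∀ s → EvenC s ⇔ ℕ.parity ∣ s ∣ ≡ 0ℙ
  evenC⇔ s = hasParity⇔ 0ℙ ∣ s ∣

  ⊤-even : EvenC (⊤ {n})
  ⊤-even = from (evenC⇔ ⊤) (trans (cong ℕ.parity (∣⊤∣≡n n)) n-even)

  even-self⇔ : ∀ {v} → ProperV v →
               EvenV v ⇔ ((¬ (ρ ⊆ v) → EvenC v) × (∀ c → Parent c v → ρ ⊆ c → EvenC c))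
  even-self⇔ {v} pv = by (position (proj₁ (proj₁ pv)))
    where
    by : Position v → EvenV v ⇔ ((¬ (ρ ⊆ v) → EvenC v) × (∀ c → Parent c v → ρ ⊆ c → EvenC c))
    by (outside ρ⊈v) = ⇔.trans (rootedParity-of-size pv (size-outside pv ρ⊈v) 0ℙ) (mk⇔
      (λ even → (λ _ → from (evenC⇔ v) even) ,
                λ c c-v (ρ⊆c : ρ ⊆ c) → ⊥-elim (ρ⊈v (⊆-trans ρ⊆c (parent-⊆ c-v))))
      (λ (even , _) → to (evenC⇔ v) (even ρ⊈v)))
    by (at ρ≡v) = mk⇔
      (λ _ → (λ ρ⊈v → ⊥-elim (ρ⊈v (⊆-reflexive ρ≡v))) ,
             λ c c-v (ρ⊆c : ρ ⊆ c) → ⊥-elim (⊂⇒⊉ (parent-⊂ c-v) (subst (_⊆ c) ρ≡v ρ⊆c)))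
      (λ _ → from (rootedParity-at pv ρ≡v 0ℙ) refl)
    by (above {c₀} c₀-v ρ⊆c₀) = ⇔.trans (rootedParity-above pv c₀-v ρ⊆c₀ 0ℙ) (mk⇔
      (λ even → (λ ρ⊈v → ⊥-elim (ρ⊈v (⊆-trans ρ⊆c₀ (parent-⊆ c₀-v)))) ,
                λ c c-v (ρ⊆c : ρ ⊆ c) →
                  subst EvenC (siblings-containing-ρ c₀-v c-v ρ⊆c₀ ρ⊆c) (from (evenC⇔ c₀) even))
      (λ (_ , even) → to (evenC⇔ c₀) (even _ c₀-v ρ⊆c₀)))

  even-children⇔ : ∀ {v} → ProperV v →
                   (∀ w → Child v w → EvenV w) ⇔
                   ((∀ c → Parent c v → ¬ (ρ ⊆ c) → EvenC c) × (ρ ⊆ v → EvenC v))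
  even-children⇔ {v} pv = mk⇔
    (λ even → (λ c c-v ρ⊈c → from (evenC⇔ c) (to (rootedParity-below (child-vertex c-v) ρ⊈c 0ℙ)
                                               (even c (from (child⇔ vv) (inj₁ (c-v , ρ⊈c)))))) ,
              λ (ρ⊆v : ρ ⊆ v) → up-even even ρ⊆v (v ≟ˢ ⊤))
    (λ (even-below , even-v) w v→w → by-child even-below even-v (to (child⇔ vv) v→w))
    where
    vv = proj₁ pv
    up-even : (∀ w → Child v w → EvenV w) → ρ ⊆ v → Dec (v ≡ ⊤) → EvenC v
    up-even _    _   (yes v≡⊤) = subst EvenC (sym v≡⊤) ⊤-even
    up-even even ρ⊆v (no v≢⊤)  = let (u , vu) = upNeighbour-exists vv v≢⊤ in
      from (evenC⇔ v) (to (rootedParity-up ρ⊆v vu 0ℙ) (even u (from (child⇔ vv) (inj₂ (vu , ρ⊆v)))))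
    by-child : ∀ {w} → (∀ c → Parent c v → ¬ (ρ ⊆ c) → EvenC c) → (ρ ⊆ v → EvenC v) →
               (Parent w v × ¬ (ρ ⊆ w)) ⊎ (UpNeighbour v w × ρ ⊆ v) → EvenV w
    by-child {w} even-below _ (inj₁ (w-v , ρ⊈w)) =
      from (rootedParity-below (child-vertex w-v) ρ⊈w 0ℙ) (to (evenC⇔ w) (even-below _ w-v ρ⊈w))
    by-child _ even-v (inj₂ (vw , ρ⊆v)) = from (rootedParity-up ρ⊆v vw 0ℙ) (to (evenC⇔ v) (even-v ρ⊆v))

  uebereven⇔ : ∀ {v} → ProperV v → UeberevenV v ⇔ Uebereven v
  uebereven⇔ {v} pv = mk⇔
    (λ (_ , even , children-even) →
       let (even-outside , even-ρ-child) = to (even-self⇔ pv) even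
           (even-below , even-inside)    = to (even-children⇔ pv) children-even
       in proper⇒Proper pv ,
          Sum.[ even-inside , even-outside ] (Dec.toSum (ρ ⊆? v)) ,
          λ c c-v → Sum.[ even-ρ-child c c-v , even-below c c-v ] (Dec.toSum (ρ ⊆? c)))
    (λ (_ , even , children-even) →
       pv , from (even-self⇔ pv) ((λ _ → even) , λ c c-v _ → children-even c c-v) ,
       from (even-children⇔ pv) ((λ c c-v _ → children-even c c-v) , λ _ → even))

  oddChild⇔ : ∀ {v w} → ProperV v →
              (Child v w × OddV w) ⇔
              ((Parent w v × OddC w × ¬ (ρ ⊆ w)) ⊎ (UpNeighbour v w × ρ ⊆ v × ℕ.parity ∣ v ∣ ≡ 1ℙ))
  oddChild⇔ {v} {w} pv = mk⇔
    (λ (v→w , odd) → by-child odd (to (child⇔ vv) v→w))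
    (λ { (inj₁ (w-v , odd , ρ⊈w)) →
           from (child⇔ vv) (inj₁ (w-v , ρ⊈w)) ,
           from (rootedParity-below (child-vertex w-v) ρ⊈w 1ℙ) (to (hasParity⇔ 1ℙ ∣ w ∣) odd)
       ; (inj₂ (vw , ρ⊆v , odd)) → from (child⇔ vv) (inj₂ (vw , ρ⊆v)) , from (rootedParity-up ρ⊆v vw 1ℙ) odd })
    where
    vv = proj₁ pv
    by-child : OddV w → (Parent w v × ¬ (ρ ⊆ w)) ⊎ (UpNeighbour v w × ρ ⊆ v) →
               (Parent w v × OddC w × ¬ (ρ ⊆ w)) ⊎ (UpNeighbour v w × ρ ⊆ v × ℕ.parity ∣ v ∣ ≡ 1ℙ)
    by-child odd (inj₁ (w-v , ρ⊈w)) =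
      inj₁ (w-v , from (hasParity⇔ 1ℙ ∣ w ∣) (to (rootedParity-below (child-vertex w-v) ρ⊈w 1ℙ) odd) , ρ⊈w)
    by-child odd (inj₂ (vw , ρ⊆v)) = inj₂ (vw , ρ⊆v , to (rootedParity-up ρ⊆v vw 1ℙ) odd)

  module Genus {v} (pv : ProperV v) where
    open Children (proper⇒Proper pv)

    ρ-free? : ∀ w → Dec (¬ (ρ ⊆ w))
    ρ-free? w = Dec.¬? (ρ ⊆? w)

    ρ-freeOddChildren : List (Subset n)
    ρ-freeOddChildren = filter ρ-free? oddChildren

    ρ-freeOddChildren-unique : Unique ρ-freeOddChildren
    ρ-freeOddChildren-unique = UniqueP.filter⁺ ρ-free? oddChildren-unique

    ∈-ρ-freeOddChildren⇔ : ∀ w → w ∈ₗ ρ-freeOddChildren ⇔ (Parent w v × OddC w × ¬ (ρ ⊆ w))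
    ∈-ρ-freeOddChildren⇔ w = mk⇔
      (λ w∈ → let (w∈odd , ρ⊈w) = ∈P.∈-filter⁻ ρ-free? {xs = oddChildren} w∈
                  (w-v , odd) = to (∈-oddChildren⇔ w) w∈odd
              in w-v , odd , ρ⊈w)
      (λ (w-v , odd , ρ⊈w) → ∈P.∈-filter⁺ ρ-free? (from (∈-oddChildren⇔ w) (w-v , odd)) ρ⊈w)

    #oddChildren-cases : length oddChildren ≡ length ρ-freeOddChildren ⊎
                         (length oddChildren ≡ suc (length ρ-freeOddChildren) × ρ ⊆ v)
    #oddChildren-cases = Sum.map₂ (Product.map₂ ρ-inside)
      (length-filter-one-rejected ρ-free? oddChildren-unique λ y∈ z∈ ¬ρ⊈y ¬ρ⊈z →
        siblings-containing-ρ (parent-of y∈) (parent-of z∈) (stable y∈ ¬ρ⊈y) (stable z∈ ¬ρ⊈z))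
      where
      parent-of : ∀ {w} → w ∈ₗ oddChildren → Parent w v
      parent-of w∈ = proj₁ (to (∈-oddChildren⇔ _) w∈)
      stable : ∀ {w} → w ∈ₗ oddChildren → ¬ ¬ (ρ ⊆ w) → ρ ⊆ w
      stable {w} _ = Dec.decidable-stable (ρ ⊆? w)
      ρ-inside : ∃[ w ] (w ∈ₗ oddChildren × ¬ ¬ (ρ ⊆ w)) → ρ ⊆ v
      ρ-inside (w , w∈ , ¬ρ⊈w) = ⊆-trans (stable w∈ ¬ρ⊈w) (parent-⊆ (parent-of w∈))

    RootedOdd : Subset n → Set
    RootedOdd w = (Parent w v × OddC w × ¬ (ρ ⊆ w)) ⊎ (UpNeighbour v w × ρ ⊆ v × ℕ.parity ∣ v ∣ ≡ 1ℙ)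

    oddChildrenV-from : ∀ {xs} → Unique xs → (∀ w → w ∈ₗ xs ⇔ RootedOdd w) → OddChildrenV v (length xs)
    oddChildrenV-from u ∈xs = _ , u , (λ w → ⇔.trans (∈xs w) (⇔.sym (oddChild⇔ pv))) , refl

    odd⇒≢⊤ : ℕ.parity ∣ v ∣ ≡ 1ℙ → v ≢ ⊤
    odd⇒≢⊤ odd v≡⊤ = ℙP.p≢p⁻¹ 0ℙ (trans (sym (to (evenC⇔ v) (subst EvenC (sym v≡⊤) ⊤-even))) odd)

    oddChildrenV-with-up : ∀ {u} → UpNeighbour v u → ρ ⊆ v → ℕ.parity ∣ v ∣ ≡ 1ℙ →
                     OddChildrenV v (suc (length ρ-freeOddChildren))
    oddChildrenV-with-up {u} vu ρ⊆v odd = oddChildrenV-from (u∉ AllPairs.∷ ρ-freeOddChildren-unique) ∈u∷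
      where
      u∉ : All (u ≢_) ρ-freeOddChildren
      u∉ = All.tabulate λ { {w} w∈ refl → upNeighbour-⊈ vu (parent-⊆ (proj₁ (to (∈-ρ-freeOddChildren⇔ w) w∈))) }
      ∈u∷ : ∀ w → w ∈ₗ u ∷ ρ-freeOddChildren ⇔ RootedOdd w
      ∈u∷ w = mk⇔ (λ { (here refl) → inj₂ (vu , ρ⊆v , odd)
                     ; (there w∈) → inj₁ (to (∈-ρ-freeOddChildren⇔ w) w∈) })
                  (λ { (inj₁ below)   → there (from (∈-ρ-freeOddChildren⇔ w) below)
                     ; (inj₂ (vw , _)) → here (upNeighbour-unique vw vu) })

    oddChildrenV-without-up : ¬ (ρ ⊆ v × ℕ.parity ∣ v ∣ ≡ 1ℙ) → OddChildrenV v (length ρ-freeOddChildren)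
    oddChildrenV-without-up ¬up = oddChildrenV-from ρ-freeOddChildren-unique λ w →
      mk⇔ (inj₁ ∘ to (∈-ρ-freeOddChildren⇔ w))
          (λ { (inj₁ below) → from (∈-ρ-freeOddChildren⇔ w) below
             ; (inj₂ (_ , ρ⊆v , odd)) → ⊥-elim (¬up (ρ⊆v , odd)) })

    rootedOddChildren : ∃[ r ] (OddChildrenV v r ×
                          ((r ≡ length ρ-freeOddChildren × (ρ ⊆ v → ℕ.parity ∣ v ∣ ≡ 0ℙ)) ⊎
                           (r ≡ suc (length ρ-freeOddChildren) × ℕ.parity ∣ v ∣ ≡ 1ℙ)))
    rootedOddChildren with (ρ ⊆? v) ×-dec (ℕ.parity ∣ v ∣ ℙP.≟ 1ℙ)
    ... | yes (ρ⊆v , odd) =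
      _ , oddChildrenV-with-up (proj₂ (upNeighbour-exists (proj₁ pv) (odd⇒≢⊤ odd))) ρ⊆v odd , inj₂ (refl , odd)
    ... | no ¬up =
      _ , oddChildrenV-without-up ¬up , inj₁ (refl , λ ρ⊆v → p≢1ℙ⇒p≡0ℙ λ odd → ¬up (ρ⊆v , odd))

    genus⇔ : ∀ k → (∃[ m ] (OddChildrenV v m × GenusCount m k)) ⇔ BYGenus v k
    genus⇔ k = ⇔.trans rooted (⇔.trans (genusCount-cong r-cases #oddChildren-cases k) clustered)
      where
      r = proj₁ rootedOddChildren
      r-odd = proj₁ (proj₂ rootedOddChildren)
      o-parity : ∀ {p} → ℕ.parity ∣ v ∣ ≡ p → ℕ.parity (length oddChildren) ≡ p
      o-parity = trans (sym parity∣s∣≡parity-#oddChildren)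
      r-cases = Sum.map (Product.map₂ (o-parity ∘_)) (Product.map₂ o-parity) (proj₂ (proj₂ rootedOddChildren))
      rooted : (∃[ m ] (OddChildrenV v m × GenusCount m k)) ⇔ GenusCount r k
      rooted = mk⇔
        (λ { (m , (xs , xs-unique , ∈xs , refl) , genus) →
               let (ys , ys-unique , ∈ys , ys≡r) = r-odd
               in subst (λ m → GenusCount m k)
                        (trans (unique∧set⇒length≡ xs-unique ys-unique λ w → ⇔.trans (∈xs w) (⇔.sym (∈ys w)))
                               ys≡r)
                        genus })
        (λ genus → r , r-odd , genus)
      clustered : GenusCount (length oddChildren) k ⇔ BYGenus v k
      clustered = mk⇔ (λ genus → length oddChildren , from (oddChildren-count _) refl , genus)
                      λ (m , odd-m , genus) → subst (λ m → GenusCount m k) (to (oddChildren-count m) odd-m) genus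

  delta⇔ : ∀ {s ℓ} → Delta s ℓ ⇔ (∃[ δ ] (Delta s δ × ℓ ≡ δ))
  delta⇔ = mk⇔ (λ δ → _ , δ , refl) λ { (_ , δ , refl) → δ }

  module YellowEdges = EdgeColour 0ℙ (λ L → L ℚ.+ L) (λ a b → interchange a b a b)
                                  (λ s ℓ → ∃[ δ ] (Delta s δ × ℓ ≡ δ ℚ.+ δ)) ⇔.refl
  module BlueEdges   = EdgeColour 1ℙ id (λ _ _ → refl) Delta delta⇔

  result≅T-Σ : BYIso result T-Σ
  result≅T-Σ = record
    { to      = id
    ; from    = id
    ; to-V    = λ _ → to properTC⇔BYVert
    ; from-V  = λ _ → from properTC⇔BYVert
    ; from-to = λ _ _ → refl
    ; to-from = λ _ _ → refl
    ; yellow  = λ _ → uebereven⇔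
    ; genus   = λ _ k pv → Genus.genus⇔ pv k
    ; yedge   = λ _ _ _ → YellowEdges.edge-iso
    ; bedge   = λ _ _ _ → BlueEdges.edge-iso
    }

proposition3p10 : (g : ℕ) → 2 ≤ g →
    (ord : Fin (2 + 2 * g) → Fin (2 + 2 * g) → ℚ) →
    Symmetric ord → Ultrametric ord →
    (ρ : Subset (2 + 2 * g)) → Trees.ProperTC ord ρ →
    BYIso (Procedure.result (Trees.T-C ord) ρ) (Trees.T-Σ ord)
proposition3p10 g 2≤g ord ord-sym ord-ultra ρ ρ-proper =
  Rooted.result≅T-Σ ord ord-sym ord-ultra 2<n (ℙP.*-homo-* 2 g) ρ ρ-proper
  where
  2<n : 2 < 2 + 2 * g
  2<n = s≤s (s≤s (ℕP.≤-trans (s≤s z≤n) (ℕP.≤-trans 2≤g (ℕP.m≤m+n g (g + 0)))))
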